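{- Let $n \geq 3$ be an integer, let $P_n$ be the path on $n$ vertices and $C_n$ the cycle on $n$ vertices. Then, for reversible peg solitaire: (1) If $n$ is divisible by neither $2$ nor $3$, then $P_n$ and $C_n$ are not solvable. (2) If $n$ is divisible by $3$, then $P_n$ is solvable but not freely solvable, and $C_n$ is freely solvable but not doubly freely solvable. (3) If $n$ is not divisible by $3$ but is divisible by $2$, then $P_n$ is solvable but not freely solvable, and $C_n$ is doubly freely solvable.
   Context: Reversible peg solitaire on a finite simple graph $G$: a configuration assigns to each vertex either a peg or a hole. If $xyz$ is a path in $G$ ($x$ adjacent to $y$, $y$ adjacent to $z$, $x,y,z$ distinct), a jump is allowed when $x$ and $y$ have pegs and $z$ has a hole: it removes the pegs from $x$ and $y$ and places a peg on $z$. An unjump is the reverse move: when $x$ and $y$ have holes and $z$ has a peg, it removes the peg from $z$ and places pegs on $x$ and $y$. $G$ is solvable if for some starting configuration with exactly one hole, some finite sequence of jumps and unjumps produces a configuration with exactly one peg. $G$ is freely solvable if this is possible from every starting configuration with exactly one hole. $G$ is doubly freely solvable if for every starting configuration with exactly one hole and every vertex $v$ of $G$, some finite sequence of jumps and unjumps produces the configuration with a single peg on $v$. -}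

module Defs where

open import Data.Nat using (ℕ; zero; suc; _+_; _≥_; s≤s; z≤n)
open import Data.Nat.Properties using (1+n≢n)
open import Data.Sum using (inj₁; inj₂)
open import Relation.Binary.PropositionalEquality using (refl; sym; trans; subst)
open import Data.Fin using (Fin; toℕ)
open import Data.Bool using (Bool; true; false)
open import Data.Product using (Σ; ∃; _×_; _,_)
open import Data.Sum using (_⊎_)
open import Relation.Nullary using (¬_)
open import Relation.Binary.PropositionalEquality using (_≡_)
open import Relation.Binary.Construct.Closure.ReflexiveTransitive using (Star)

record Graph (n : ℕ) : Set₁ where
  field
    Adj   : Fin n → Fin n → Set
    adj-sym : ∀ {x y} → Adj x y → Adj y x
    irrefl  : ∀ {x} → ¬ Adj x x
open Graph public

-- A configuration: true = peg, false = hole.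
Config : ℕ → Set
Config n = Fin n → Bool

record Move {n : ℕ} (G : Graph n) (c c' : Config n) : Set where
  field
    x y z   : Fin n
    adj-xy  : Adj G x y
    adj-yz  : Adj G y z
    x≢y     : ¬ x ≡ y
    y≢z     : ¬ y ≡ z
    x≢z     : ¬ x ≡ z
    same    : ∀ w → ¬ w ≡ x → ¬ w ≡ y → ¬ w ≡ z → c' w ≡ c w
    jump-or-unjump :
      (c x ≡ true × c y ≡ true × c z ≡ false ×
       c' x ≡ false × c' y ≡ false × c' z ≡ true)
      ⊎
      (c x ≡ false × c y ≡ false × c z ≡ true ×
       c' x ≡ true × c' y ≡ true × c' z ≡ false)

Reachable : ∀ {n} → Graph n → Config n → Config n → Set
Reachable G = Star (Move G)

HoleAt : ∀ {n} → Fin n → Config n → Set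
HoleAt v c = c v ≡ false × (∀ w → ¬ w ≡ v → c w ≡ true)

PegAt : ∀ {n} → Fin n → Config n → Set
PegAt v c = c v ≡ true × (∀ w → ¬ w ≡ v → c w ≡ false)

OneHole : ∀ {n} → Config n → Set
OneHole c = ∃ λ v → HoleAt v c

OnePeg : ∀ {n} → Config n → Set
OnePeg c = ∃ λ v → PegAt v c

Solvable : ∀ {n} → Graph n → Set
Solvable {n} G = Σ (Config n) λ c → OneHole c ×
                   Σ (Config n) λ d → OnePeg d × Reachable G c d

FreelySolvable : ∀ {n} → Graph n → Set
FreelySolvable {n} G = (c : Config n) → OneHole c →
                   Σ (Config n) λ d → OnePeg d × Reachable G c d

DoublyFreelySolvable : ∀ {n} → Graph n → Set
DoublyFreelySolvable {n} G = (c : Config n) → OneHole c → (v : Fin n) →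
                   Σ (Config n) λ d → PegAt v d × Reachable G c d

PathAdj : ∀ {n} → Fin n → Fin n → Set
PathAdj i j = suc (toℕ i) ≡ toℕ j ⊎ suc (toℕ j) ≡ toℕ i

CycleAdj : ∀ n → Fin n → Fin n → Set
CycleAdj n i j = PathAdj i j ⊎
                 (toℕ i ≡ 0 × suc (toℕ j) ≡ n) ⊎ (toℕ j ≡ 0 × suc (toℕ i) ≡ n)

private
  path-irr : ∀ {n} {i : Fin n} → ¬ PathAdj i i
  path-irr {i = i} (inj₁ e) = 1+n≢n e
  path-irr {i = i} (inj₂ e) = 1+n≢n e

  path-sym : ∀ {n} {i j : Fin n} → PathAdj i j → PathAdj j i
  path-sym (inj₁ e) = inj₂ e
  path-sym (inj₂ e) = inj₁ e

  cyc-sym : ∀ {n} {i j : Fin n} → CycleAdj n i j → CycleAdj n j i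
  cyc-sym (inj₁ p) = inj₁ (path-sym p)
  cyc-sym (inj₂ (inj₁ p)) = inj₂ (inj₂ p)
  cyc-sym (inj₂ (inj₂ p)) = inj₂ (inj₁ p)

  cyc-irr : ∀ {n} → n ≥ 3 → {i : Fin n} → ¬ CycleAdj n i i
  cyc-irr _ (inj₁ p) = path-irr p
  cyc-irr {n} (s≤s (s≤s (s≤s _))) {i} (inj₂ (inj₁ (e0 , e))) rewrite e0 with e
  ... | ()
  cyc-irr {n} (s≤s (s≤s (s≤s _))) {i} (inj₂ (inj₂ (e0 , e))) rewrite e0 with e
  ... | ()

P : (n : ℕ) → Graph n
P n = record { Adj = PathAdj ; adj-sym = path-sym ; irrefl = path-irr }

C : (n : ℕ) → n ≥ 3 → Graph n
C n h = record { Adj = CycleAdj n ; adj-sym = cyc-sym ; irrefl = cyc-irr h }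

-- Give a peg the matrix A = [[1,1],[0,1]] and a hole the matrix B = [[0,2],[1,1]] over 𝔽₃.
-- A move replaces a window AAB by BBA or BAA by ABB (or conversely), and these products
-- agree, so along the path the ordered product of a configuration is invariant, and around
-- the cycle its trace is.  A one-hole and a one-peg configuration have products
-- A^v B A^(n-1-v) and B^w A B^(n-1-w); since A⁶ = B⁶ = 1 these can be compared by a finite
-- computation, which rules out solutions of Cₙ when gcd(n, 6) = 1 and, for each residue of
-- n mod 6, exhibits a hole of Pₙ that cannot be solved.  On C₃ₖ a move flips one vertex of
-- each residue class mod 3, so the parity of the number of pegs at positions ≢ 0 (mod 3)
-- is invariant; it separates a hole at 0 from a peg at 1.
--
-- Conversely, a fixed sequence of moves clears six consecutive pegs, which solves Pₙ from
-- a suitable hole whenever 2 ∣ n or 3 ∣ n.  Rotating the cycle transports that solution to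
-- every hole of Cₙ, and when 3 ∤ n two moves shift a lone hole (or peg) by three places,
-- which together with rotations connects all its positions.
module Submission where

open import Defs
open import Data.Nat as ℕ using (ℕ; zero; suc; _+_; _∸_; _*_; _≤_; _<_; _≥_; _<?_; s≤s; z≤n; z<s; NonZero)
open import Data.Nat.Properties
  using ( +-suc; +-identityʳ; +-comm; +-assoc; +-commutativeSemigroup; suc-injective
        ; ≤-refl; ≤-trans; ≤-reflexive; ≤-pred; <-trans; <-irrefl; <⇒≤; <⇒≢; >⇒≢; n≤1+n; n<1+n
        ; 1+n≢0; m≤m+n; m≤n+m; m<m+n; m<n⇒m<1+n; m≤n⇒m<n∨m≡n; m+[n∸m]≡n )
open import Algebra.Properties.CommutativeSemigroup +-commutativeSemigroup using (x∙yz≈y∙xz)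
open import Data.Nat.DivMod using (_%_; _/_; _mod_; m%n<n; m≡m%n+[m/n]*n; %-distribˡ-+; [m+kn]%n≡m%n; _divMod_; result)
open import Data.Nat.Divisibility using (_∣_; _∣?_; divides; ∣-trans; n∣m*n; ∣m+n∣m⇒∣n; ∣m∣n⇒∣m+n)
open import Data.Bool using (Bool; true; false; not; _∧_; _xor_; if_then_else_)
open import Data.Bool.Properties
  using (xor-∧-commutativeRing; xor-comm; xor-identityʳ; true-xor; ∧-identityʳ; ∧-zeroʳ)
  renaming (_≟_ to _≟ᴮ_)
open import Data.Fin using (Fin; toℕ; fromℕ<; fromℕ; inject₁; zero; suc)
open import Data.Fin.Patterns using (0F; 1F; 2F; 3F; 4F; 5F)
import Data.Fin.Properties as Fin
open import Data.Fin.Properties using (_≟_; toℕ≤pred[n]; all?; toℕ-injective; toℕ<n; toℕ-fromℕ<; fromℕ<-toℕ; toℕ-fromℕ; toℕ-inject₁)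
open import Data.List using (List; []; _∷_; _++_; length; replicate)
open import Data.List.Properties using (length-++; length-replicate)
open import Data.Maybe using (Maybe; just; nothing; _>>=_)
import Data.Maybe as Maybe
open import Data.Product using (Σ; _×_; _,_; proj₁; proj₂; map₁; map₂)
open import Data.Sum using (_⊎_; inj₁; inj₂; [_,_])
open import Data.Empty using (⊥-elim)
open import Algebra.Core using (Op₂)
open import Algebra.Definitions using (Associative)
open import Algebra.Structures using (IsMonoid)
open import Algebra.Bundles using (CommutativeRing)
open import Function using (_∘_; id)
open import Relation.Nullary using (¬_; Dec; yes; no; does)
open import Relation.Nullary.Decidable using (from-yes; from-no; map′; _×-dec_; _→-dec_; ¬?; dec-true; dec-false)
open import Relation.Binary.Definitions using (DecidableEquality)
open import Relation.Binary.PropositionalEquality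
  using (_≡_; _≢_; _≗_; refl; sym; trans; cong; cong₂; subst; subst₂; isEquivalence; module ≡-Reasoning)
open import Relation.Binary.Construct.Closure.ReflexiveTransitive using (Star; ε; _◅_; _◅◅_; gmap; fold; reverse)

-- The field 𝔽₃ and 2 × 2 matrices over it

𝔽₃ : Set
𝔽₃ = Fin 3

infixl 6 _+₃_
infixl 7 _*₃_

_+₃_ _*₃_ : 𝔽₃ → 𝔽₃ → 𝔽₃
x +₃ y = (toℕ x + toℕ y) mod 3
x *₃ y = (toℕ x * toℕ y) mod 3

+₃-interchange : ∀ x y z w → (x +₃ y) +₃ (z +₃ w) ≡ (x +₃ z) +₃ (y +₃ w)
+₃-interchange =
  from-yes (all? λ x → all? λ y → all? λ z → all? λ w → (x +₃ y) +₃ (z +₃ w) ≟ (x +₃ z) +₃ (y +₃ w))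

+₃-identityˡ : ∀ x → 0F +₃ x ≡ x
+₃-identityˡ = from-yes (all? λ x → 0F +₃ x ≟ x)

+₃-identityʳ : ∀ x → x +₃ 0F ≡ x
+₃-identityʳ = from-yes (all? λ x → x +₃ 0F ≟ x)

*₃-assoc : ∀ x y z → (x *₃ y) *₃ z ≡ x *₃ (y *₃ z)
*₃-assoc = from-yes (all? λ x → all? λ y → all? λ z → (x *₃ y) *₃ z ≟ x *₃ (y *₃ z))

*₃-comm : ∀ x y → x *₃ y ≡ y *₃ x
*₃-comm = from-yes (all? λ x → all? λ y → x *₃ y ≟ y *₃ x)

*₃-distribˡ-+₃ : ∀ x y z → x *₃ (y +₃ z) ≡ x *₃ y +₃ x *₃ z
*₃-distribˡ-+₃ = from-yes (all? λ x → all? λ y → all? λ z → x *₃ (y +₃ z) ≟ x *₃ y +₃ x *₃ z)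

*₃-distribʳ-+₃ : ∀ x y z → (y +₃ z) *₃ x ≡ y *₃ x +₃ z *₃ x
*₃-distribʳ-+₃ = from-yes (all? λ x → all? λ y → all? λ z → (y +₃ z) *₃ x ≟ y *₃ x +₃ z *₃ x)

*₃-identityˡ : ∀ x → 1F *₃ x ≡ x
*₃-identityˡ = from-yes (all? λ x → 1F *₃ x ≟ x)

*₃-identityʳ : ∀ x → x *₃ 1F ≡ x
*₃-identityʳ = from-yes (all? λ x → x *₃ 1F ≟ x)

*₃-zeroˡ : ∀ x → 0F *₃ x ≡ 0F
*₃-zeroˡ = from-yes (all? λ x → 0F *₃ x ≟ 0F)

*₃-zeroʳ : ∀ x → x *₃ 0F ≡ 0F
*₃-zeroʳ = from-yes (all? λ x → x *₃ 0F ≟ 0F)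

record Mat : Set where
  constructor mat
  field a b c d : 𝔽₃

infixl 7 _·_
_·_ : Mat → Mat → Mat
mat a b c d · mat a' b' c' d' =
  mat (a *₃ a' +₃ b *₃ c') (a *₃ b' +₃ b *₃ d') (c *₃ a' +₃ d *₃ c') (c *₃ b' +₃ d *₃ d')

I : Mat
I = mat 1F 0F 0F 1F

tr : Mat → 𝔽₃
tr (mat a _ _ d) = a +₃ d

infix 4 _≟ᴹ_
_≟ᴹ_ : DecidableEquality Mat
mat a b c d ≟ᴹ mat a' b' c' d' =
  map′ (λ { (refl , refl , refl , refl) → refl }) (λ { refl → refl , refl , refl , refl })
       (a ≟ a' ×-dec b ≟ b' ×-dec c ≟ c' ×-dec d ≟ d')

row·col-assoc : ∀ a b e f g h i k →
  (a *₃ e +₃ b *₃ g) *₃ i +₃ (a *₃ f +₃ b *₃ h) *₃ k ≡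
  a *₃ (e *₃ i +₃ f *₃ k) +₃ b *₃ (g *₃ i +₃ h *₃ k)
row·col-assoc a b e f g h i k = begin
  (a *₃ e +₃ b *₃ g) *₃ i +₃ (a *₃ f +₃ b *₃ h) *₃ k
    ≡⟨ cong₂ _+₃_ (*₃-distribʳ-+₃ i (a *₃ e) (b *₃ g)) (*₃-distribʳ-+₃ k (a *₃ f) (b *₃ h)) ⟩
  (a *₃ e *₃ i +₃ b *₃ g *₃ i) +₃ (a *₃ f *₃ k +₃ b *₃ h *₃ k)
    ≡⟨ +₃-interchange (a *₃ e *₃ i) (b *₃ g *₃ i) (a *₃ f *₃ k) (b *₃ h *₃ k) ⟩
  (a *₃ e *₃ i +₃ a *₃ f *₃ k) +₃ (b *₃ g *₃ i +₃ b *₃ h *₃ k)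
    ≡⟨ cong₂ _+₃_ (cong₂ _+₃_ (*₃-assoc a e i) (*₃-assoc a f k)) (cong₂ _+₃_ (*₃-assoc b g i) (*₃-assoc b h k)) ⟩
  (a *₃ (e *₃ i) +₃ a *₃ (f *₃ k)) +₃ (b *₃ (g *₃ i) +₃ b *₃ (h *₃ k))
    ≡⟨ sym (cong₂ _+₃_ (*₃-distribˡ-+₃ a (e *₃ i) (f *₃ k)) (*₃-distribˡ-+₃ b (g *₃ i) (h *₃ k))) ⟩
  a *₃ (e *₃ i +₃ f *₃ k) +₃ b *₃ (g *₃ i +₃ h *₃ k) ∎
  where open ≡-Reasoning

·-assoc : Associative _≡_ _·_
·-assoc (mat a b c d) (mat e f g h) (mat i j k l) =
  trans (cong₂ (λ x y → mat x y _ _) (row·col-assoc a b e f g h i k) (row·col-assoc a b e f g h j l))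
        (cong₂ (λ x y → mat _ _ x y) (row·col-assoc c d e f g h i k) (row·col-assoc c d e f g h j l))

·-identityˡ : ∀ X → I · X ≡ X
·-identityˡ (mat a b c d) =
  trans (cong₂ (λ x y → mat x y _ _) (unit a c) (unit b d)) (cong₂ (λ x y → mat _ _ x y) (unit′ a c) (unit′ b d))
  where
  unit : ∀ x y → 1F *₃ x +₃ 0F *₃ y ≡ x
  unit x y = trans (cong₂ _+₃_ (*₃-identityˡ x) (*₃-zeroˡ y)) (+₃-identityʳ x)
  unit′ : ∀ x y → 0F *₃ x +₃ 1F *₃ y ≡ y
  unit′ x y = trans (cong₂ _+₃_ (*₃-zeroˡ x) (*₃-identityˡ y)) (+₃-identityˡ y)

·-identityʳ : ∀ X → X · I ≡ X
·-identityʳ (mat a b c d) =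
  trans (cong₂ (λ x y → mat x y _ _) (unit a b) (unit′ a b)) (cong₂ (λ x y → mat _ _ x y) (unit c d) (unit′ c d))
  where
  unit : ∀ x y → x *₃ 1F +₃ y *₃ 0F ≡ x
  unit x y = trans (cong₂ _+₃_ (*₃-identityʳ x) (*₃-zeroʳ y)) (+₃-identityʳ x)
  unit′ : ∀ x y → x *₃ 0F +₃ y *₃ 1F ≡ y
  unit′ x y = trans (cong₂ _+₃_ (*₃-zeroʳ x) (*₃-identityʳ y)) (+₃-identityˡ y)

·-isMonoid : IsMonoid _≡_ _·_ I
·-isMonoid = record
  { isSemigroup = record { isMagma = record { isEquivalence = isEquivalence ; ∙-cong = cong₂ _·_ } ; assoc = ·-assoc }
  ; identity    = ·-identityˡ , ·-identityʳ }

tr-cyclic : ∀ X Y → tr (X · Y) ≡ tr (Y · X)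
tr-cyclic (mat a b c d) (mat e f g h) =
  trans (+₃-interchange (a *₃ e) (b *₃ g) (c *₃ f) (d *₃ h))
        (cong₂ _+₃_ (cong₂ _+₃_ (*₃-comm a e) (*₃-comm c f)) (cong₂ _+₃_ (*₃-comm b g) (*₃-comm d h)))

-- Products over a range in a monoid

CyclicSucc : ℕ → ℕ → ℕ → Set
CyclicSucc n a b = b ≡ suc a ⊎ (b ≡ 0 × suc a ≡ n)

module MonoidProduct {A : Set} {_•_ : Op₂ A} {ε : A} (isMonoid : IsMonoid _≡_ _•_ ε) where
  open IsMonoid isMonoid using (assoc; identityˡ; identityʳ)
  open ≡-Reasoning

  infixl 7 _∙_
  _∙_ : Op₂ A
  _∙_ = _•_

  ∏ : (ℕ → A) → ℕ → ℕ → A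
  ∏ φ s zero    = ε
  ∏ φ s (suc m) = φ s ∙ ∏ φ (suc s) m

  infixr 8 _^_
  _^_ : A → ℕ → A
  x ^ zero  = ε
  x ^ suc m = x ∙ x ^ m

  ∏-+ : ∀ φ s a b → ∏ φ s (a + b) ≡ ∏ φ s a ∙ ∏ φ (s + a) b
  ∏-+ φ s zero    b = begin
    ∏ φ s b            ≡⟨ cong (λ t → ∏ φ t b) (sym (+-identityʳ s)) ⟩
    ∏ φ (s + 0) b      ≡⟨ sym (identityˡ _) ⟩
    ε ∙ ∏ φ (s + 0) b  ∎
  ∏-+ φ s (suc a) b = begin
    φ s ∙ ∏ φ (suc s) (a + b)                  ≡⟨ cong (φ s ∙_) (∏-+ φ (suc s) a b) ⟩
    φ s ∙ (∏ φ (suc s) a ∙ ∏ φ (suc s + a) b)  ≡⟨ sym (assoc _ _ _) ⟩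
    φ s ∙ ∏ φ (suc s) a ∙ ∏ φ (suc s + a) b    ≡⟨ cong (λ t → φ s ∙ ∏ φ (suc s) a ∙ ∏ φ t b) (sym (+-suc s a)) ⟩
    φ s ∙ ∏ φ (suc s) a ∙ ∏ φ (s + suc a) b    ∎

  ∏-cong : ∀ {φ ψ} s m → (∀ k → s ≤ k → k < s + m → φ k ≡ ψ k) → ∏ φ s m ≡ ∏ ψ s m
  ∏-cong         s zero    eq = refl
  ∏-cong {φ} {ψ} s (suc m) eq = cong₂ _∙_ (eq s ≤-refl s<s+1+m) (∏-cong (suc s) m tail)
    where
    s<s+1+m : s < s + suc m
    s<s+1+m = subst (s <_) (sym (+-suc s m)) (s≤s (m≤m+n s m))
    tail : ∀ k → suc s ≤ k → k < suc s + m → φ k ≡ ψ k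
    tail k s<k k<1+s+m = eq k (≤-trans (n≤1+n s) s<k) (subst (k <_) (sym (+-suc s m)) k<1+s+m)

  ∏-const : ∀ {φ x} s m → (∀ k → s ≤ k → k < s + m → φ k ≡ x) → ∏ φ s m ≡ x ^ m
  ∏-const {φ} {x} s m eq = trans (∏-cong s m eq) (∏-constant s m)
    where
    ∏-constant : ∀ s m → ∏ (λ _ → x) s m ≡ x ^ m
    ∏-constant s zero    = refl
    ∏-constant s (suc m) = cong (x ∙_) (∏-constant (suc s) m)

  ^-+ : ∀ x a b → x ^ (a + b) ≡ x ^ a ∙ x ^ b
  ^-+ x zero    b = sym (identityˡ _)
  ^-+ x (suc a) b = trans (cong (x ∙_) (^-+ x a b)) (sym (assoc x _ _))

  ε^ : ∀ m → ε ^ m ≡ ε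
  ε^ zero    = refl
  ε^ (suc m) = trans (identityˡ _) (ε^ m)

  ^-periodic : ∀ {x p} → x ^ p ≡ ε → ∀ r k → x ^ (r + k * p) ≡ x ^ r
  ^-periodic {x} {p} xᵖ≡ε r k = begin
    x ^ (r + k * p)      ≡⟨ ^-+ x r (k * p) ⟩
    x ^ r ∙ x ^ (k * p)  ≡⟨ cong (x ^ r ∙_) (^-kp k) ⟩
    x ^ r ∙ ε            ≡⟨ identityʳ _ ⟩
    x ^ r                ∎
    where
    ^-kp : ∀ k → x ^ (k * p) ≡ ε
    ^-kp zero    = refl
    ^-kp (suc k) = trans (^-+ x p (k * p)) (trans (cong₂ _∙_ xᵖ≡ε (^-kp k)) (identityˡ ε))

  ^-mod : ∀ {x p} .{{_ : NonZero p}} → x ^ p ≡ ε → ∀ t → x ^ t ≡ x ^ (t % p)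
  ^-mod {x} {p} xᵖ≡ε t = trans (cong (x ^_) (m≡m%n+[m/n]*n t p)) (^-periodic xᵖ≡ε (t % p) (t / p))

  ∏-single : ∀ {φ x y} v m → (∀ k → k < v + suc m → k ≢ v → φ k ≡ x) → φ v ≡ y →
    ∏ φ 0 (v + suc m) ≡ x ^ v ∙ (y ∙ x ^ m)
  ∏-single {φ} {x} {y} v m eq φv≡y = begin
    ∏ φ 0 (v + suc m)              ≡⟨ ∏-+ φ 0 v (suc m) ⟩
    ∏ φ 0 v ∙ (φ v ∙ ∏ φ (suc v) m) ≡⟨ cong₂ (λ a b → a ∙ (b ∙ _)) (∏-const 0 v below) φv≡y ⟩
    x ^ v ∙ (y ∙ ∏ φ (suc v) m)     ≡⟨ cong (λ a → x ^ v ∙ (y ∙ a)) (∏-const (suc v) m above) ⟩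
    x ^ v ∙ (y ∙ x ^ m)             ∎
    where
    below : ∀ k → 0 ≤ k → k < v → φ k ≡ x
    below k _ k<v = eq k (<-trans k<v (subst (v <_) (sym (+-suc v m)) (s≤s (m≤m+n v m)))) (<⇒≢ k<v)
    above : ∀ k → suc v ≤ k → k < suc v + m → φ k ≡ x
    above k v<k k<1+v+m = eq k (subst (k <_) (sym (+-suc v m)) k<1+v+m) (λ k≡v → <-irrefl (sym k≡v) v<k)

  ∙-assoc₃ : ∀ x y z w → x ∙ (y ∙ (z ∙ w)) ≡ x ∙ y ∙ z ∙ w
  ∙-assoc₃ x y z w = trans (sym (assoc x y (z ∙ w))) (sym (assoc (x ∙ y) z w))

  ∏-window : ∀ {φ ψ} n p → 3 + p ≤ n → (∀ k → k ≢ p → k ≢ suc p → k ≢ suc (suc p) → φ k ≡ ψ k) →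
    φ p ∙ φ (suc p) ∙ φ (suc (suc p)) ≡ ψ p ∙ ψ (suc p) ∙ ψ (suc (suc p)) →
    ∏ φ 0 n ≡ ∏ ψ 0 n
  ∏-window {φ} {ψ} n p 3+p≤n outside window = begin
    ∏ φ 0 n                                                       ≡⟨ cong (∏ φ 0) (sym p+[3+m]≡n) ⟩
    ∏ φ 0 (p + (3 + m))                                           ≡⟨ ∏-+ φ 0 p (3 + m) ⟩
    ∏ φ 0 p ∙ (φ p ∙ (φ (1 + p) ∙ (φ (2 + p) ∙ ∏ φ (3 + p) m)))   ≡⟨ cong (∏ φ 0 p ∙_) (∙-assoc₃ _ _ _ _) ⟩
    ∏ φ 0 p ∙ (φ p ∙ φ (1 + p) ∙ φ (2 + p) ∙ ∏ φ (3 + p) m)       ≡⟨ cong₂ _∙_ (∏-cong 0 p before)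
                                                                          (cong₂ _∙_ window (∏-cong (3 + p) m after)) ⟩
    ∏ ψ 0 p ∙ (ψ p ∙ ψ (1 + p) ∙ ψ (2 + p) ∙ ∏ ψ (3 + p) m)       ≡⟨ cong (∏ ψ 0 p ∙_) (sym (∙-assoc₃ _ _ _ _)) ⟩
    ∏ ψ 0 p ∙ (ψ p ∙ (ψ (1 + p) ∙ (ψ (2 + p) ∙ ∏ ψ (3 + p) m)))   ≡⟨ sym (∏-+ ψ 0 p (3 + m)) ⟩
    ∏ ψ 0 (p + (3 + m))                                           ≡⟨ cong (∏ ψ 0) p+[3+m]≡n ⟩
    ∏ ψ 0 n                                                       ∎
    where
    m : ℕ
    m = n ∸ (3 + p)
    p+[3+m]≡n : p + (3 + m) ≡ n
    p+[3+m]≡n = trans (trans (sym (+-assoc p 3 m)) (cong (_+ m) (+-comm p 3))) (m+[n∸m]≡n 3+p≤n)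
    before : ∀ k → 0 ≤ k → k < p → φ k ≡ ψ k
    before k _ k<p = outside k (<⇒≢ k<p) (<⇒≢ (m<n⇒m<1+n k<p)) (<⇒≢ (m<n⇒m<1+n (m<n⇒m<1+n k<p)))
    after : ∀ k → 3 + p ≤ k → k < 3 + p + m → φ k ≡ ψ k
    after k 2+p<k _ = outside k (>⇒≢ (<-trans (n<1+n p) 1+p<k)) (>⇒≢ 1+p<k) (>⇒≢ 2+p<k)
      where
      1+p<k : suc p < k
      1+p<k = <-trans (n<1+n (suc p)) 2+p<k

  -- A window straddling position 0 becomes a block at the front once the product is rotated inside t.
  module Cyclic {B : Set} (t : A → B) (t-cyclic : ∀ x y → t (x ∙ y) ≡ t (y ∙ x)) where

    t∏-wrapped-window : ∀ {φ ψ} a m b → (∀ k → a ≤ k → k < a + m → φ k ≡ ψ k) →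
      ∏ φ (a + m) b ∙ ∏ φ 0 a ≡ ∏ ψ (a + m) b ∙ ∏ ψ 0 a →
      t (∏ φ 0 (a + m + b)) ≡ t (∏ ψ 0 (a + m + b))
    t∏-wrapped-window {φ} {ψ} a m b middle window = begin
      t (∏ φ 0 (a + m + b))                     ≡⟨ rotate φ ⟩
      t (∏ φ (a + m) b ∙ ∏ φ 0 a ∙ ∏ φ a m)     ≡⟨ cong t (cong₂ _∙_ window (∏-cong a m middle)) ⟩
      t (∏ ψ (a + m) b ∙ ∏ ψ 0 a ∙ ∏ ψ a m)     ≡⟨ sym (rotate ψ) ⟩
      t (∏ ψ 0 (a + m + b))                     ∎
      where
      rotate : ∀ χ → t (∏ χ 0 (a + m + b)) ≡ t (∏ χ (a + m) b ∙ ∏ χ 0 a ∙ ∏ χ a m)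
      rotate χ = begin
        t (∏ χ 0 (a + m + b))                     ≡⟨ cong t (∏-+ χ 0 (a + m) b) ⟩
        t (∏ χ 0 (a + m) ∙ ∏ χ (a + m) b)         ≡⟨ t-cyclic _ _ ⟩
        t (∏ χ (a + m) b ∙ ∏ χ 0 (a + m))         ≡⟨ cong (λ x → t (∏ χ (a + m) b ∙ x)) (∏-+ χ 0 a m) ⟩
        t (∏ χ (a + m) b ∙ (∏ χ 0 a ∙ ∏ χ a m))   ≡⟨ cong t (sym (assoc _ _ _)) ⟩
        t (∏ χ (a + m) b ∙ ∏ χ 0 a ∙ ∏ χ a m)     ∎

    t∏-window : ∀ {φ ψ} n p q r → 3 ≤ n → r < n → CyclicSucc n p q → CyclicSucc n q r →
      (∀ k → k ≢ p → k ≢ q → k ≢ r → φ k ≡ ψ k) → φ p ∙ φ q ∙ φ r ≡ ψ p ∙ ψ q ∙ ψ r →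
      t (∏ φ 0 n) ≡ t (∏ ψ 0 n)
    t∏-window n p _ _ _ r<n (inj₁ refl) (inj₁ refl) outside window = cong t (∏-window n p r<n outside window)
    t∏-window {φ} {ψ} _ (suc (suc m)) _ _ _ _ (inj₂ (refl , refl)) (inj₁ refl) outside window =
      subst (λ n → t (∏ φ 0 n) ≡ t (∏ ψ 0 n)) (+-comm (2 + m) 1)
        (t∏-wrapped-window 2 m 1 middle (trans (wrap₁ _ _ _) (trans window (sym (wrap₁ _ _ _)))))
      where
      wrap₁ : ∀ x y z → (x ∙ ε) ∙ (y ∙ (z ∙ ε)) ≡ x ∙ y ∙ z
      wrap₁ x y z = trans (cong₂ _∙_ (identityʳ x) (cong (y ∙_) (identityʳ z))) (sym (assoc x y z))
      middle : ∀ k → 2 ≤ k → k < 2 + m → φ k ≡ ψ k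
      middle k 1<k k<2+m = outside k (<⇒≢ k<2+m) (>⇒≢ (<-trans (n<1+n 0) 1<k)) (>⇒≢ 1<k)
    t∏-window {φ} {ψ} _ (suc m) _ _ _ _ (inj₁ refl) (inj₂ (refl , refl)) outside window =
      subst (λ n → t (∏ φ 0 n) ≡ t (∏ ψ 0 n)) (+-comm (1 + m) 2)
        (t∏-wrapped-window 1 m 2 middle (trans (wrap₂ _ _ _) (trans window (sym (wrap₂ _ _ _)))))
      where
      wrap₂ : ∀ x y z → (x ∙ (y ∙ ε)) ∙ (z ∙ ε) ≡ x ∙ y ∙ z
      wrap₂ x y z = cong₂ _∙_ (cong (x ∙_) (identityʳ y)) (identityʳ z)
      middle : ∀ k → 1 ≤ k → k < 1 + m → φ k ≡ ψ k
      middle k 0<k k<1+m = outside k (<⇒≢ k<1+m) (<⇒≢ (m<n⇒m<1+n k<1+m)) (>⇒≢ 0<k)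
    t∏-window _ zero _ _ (s≤s ()) _ (inj₂ (refl , refl)) (inj₂ (_ , refl)) _ _
    t∏-window _ zero _ _ (s≤s (s≤s ())) _ (inj₁ refl) (inj₂ (refl , refl)) _ _
    t∏-window _ (suc zero) _ _ (s≤s (s≤s ())) _ (inj₂ (refl , refl)) (inj₁ refl) _ _

-- Configurations and the window of a move

-- Vertices k ≥ n read as holes.
at : ∀ {n} → Config n → ℕ → Bool
at {n} c k with k <? n
... | yes k<n = c (fromℕ< k<n)
... | no  _   = false

at-< : ∀ {n} (c : Config n) {k} (k<n : k < n) → at c k ≡ c (fromℕ< k<n)
at-< {n} c {k} k<n with k <? n
... | yes _    = refl
... | no  k≮n  = ⊥-elim (k≮n k<n)

at-toℕ : ∀ {n} (c : Config n) v → at c (toℕ v) ≡ c v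
at-toℕ c v = trans (at-< c (toℕ<n v)) (cong c (fromℕ<-toℕ v _))

at-agree : ∀ {n} {c c' : Config n} {x y z : Fin n} → (∀ w → w ≢ x → w ≢ y → w ≢ z → c' w ≡ c w) →
  ∀ k → k ≢ toℕ x → k ≢ toℕ y → k ≢ toℕ z → at c k ≡ at c' k
at-agree {n} {c} {c'} same k k≢x k≢y k≢z with k <? n
... | yes k<n = sym (same (fromℕ< k<n) (avoids k≢x) (avoids k≢y) (avoids k≢z))
  where
  avoids : ∀ {v} → k ≢ toℕ v → fromℕ< k<n ≢ v
  avoids k≢v refl = k≢v (sym (toℕ-fromℕ< k<n))
... | no  _   = refl

OneOddAt : ∀ {n} → Bool → Fin n → Config n → Set
OneOddAt b v c = c v ≡ not b × (∀ w → w ≢ v → c w ≡ b)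

oneOdd : ∀ {n} → Bool → ℕ → Config n
oneOdd b t w = b xor does (toℕ w ℕ.≟ t)

oneOdd-OneOddAt : ∀ {n} b (v : Fin n) → OneOddAt b v (oneOdd b (toℕ v))
oneOdd-OneOddAt b v =
  trans (cong (b xor_) (dec-true (toℕ v ℕ.≟ toℕ v) refl)) (trans (xor-comm b true) (true-xor b)) ,
  λ w w≢v → trans (cong (b xor_) (dec-false (toℕ w ℕ.≟ toℕ v) (w≢v ∘ toℕ-injective))) (xor-identityʳ b)

OneOddAt⇒≗ : ∀ {n b} {v : Fin n} {c} → OneOddAt b v c → c ≗ oneOdd b (toℕ v)
OneOddAt⇒≗ {b = b} {v} (cv , cw) w with w ≟ v
... | yes refl = trans cv (sym (proj₁ (oneOdd-OneOddAt b v)))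
... | no  w≢v  = trans (cw w w≢v) (sym (proj₂ (oneOdd-OneOddAt b v) w w≢v))

at-OneOddAt : ∀ {n b} {v : Fin n} {c} → OneOddAt b v c → ∀ k → k < n → k ≢ toℕ v → at c k ≡ b
at-OneOddAt (_ , cw) k k<n k≢v = trans (at-< _ k<n) (cw _ λ e → k≢v (trans (sym (toℕ-fromℕ< k<n)) (cong toℕ e)))

JumpOrUnjump : Bool → Bool → Bool → Bool → Bool → Bool → Set
JumpOrUnjump a b c a' b' c' =
  (a ≡ true × b ≡ true × c ≡ false × a' ≡ false × b' ≡ false × c' ≡ true) ⊎
  (a ≡ false × b ≡ false × c ≡ true × a' ≡ true × b' ≡ true × c' ≡ false)

JumpOrUnjump-resp : ∀ {a b c a' b' c' a₁ b₁ c₁ a₁' b₁' c₁'} →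
  a₁ ≡ a → b₁ ≡ b → c₁ ≡ c → a₁' ≡ a' → b₁' ≡ b' → c₁' ≡ c' →
  JumpOrUnjump a b c a' b' c' → JumpOrUnjump a₁ b₁ c₁ a₁' b₁' c₁'
JumpOrUnjump-resp refl refl refl refl refl refl j = j

-- Vertices are listed in increasing order; ⁻ marks a move towards smaller positions.
data MovePattern : Bool → Bool → Bool → Bool → Bool → Bool → Set where
  jump⁺   : MovePattern true  true  false false false true
  unjump⁺ : MovePattern false false true  true  true  false
  jump⁻   : MovePattern false true  true  true  false false
  unjump⁻ : MovePattern true  false false false true  true

pattern⁺ : ∀ {a b c a' b' c'} → JumpOrUnjump a b c a' b' c' → MovePattern a b c a' b' c'
pattern⁺ (inj₁ (refl , refl , refl , refl , refl , refl)) = jump⁺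
pattern⁺ (inj₂ (refl , refl , refl , refl , refl , refl)) = unjump⁺

pattern⁻ : ∀ {a b c a' b' c'} → JumpOrUnjump a b c a' b' c' → MovePattern c b a c' b' a'
pattern⁻ (inj₁ (refl , refl , refl , refl , refl , refl)) = jump⁻
pattern⁻ (inj₂ (refl , refl , refl , refl , refl , refl)) = unjump⁻

record Window (Succ : ℕ → ℕ → Set) (n : ℕ) (f f' : ℕ → Bool) : Set where
  field
    p q r     : ℕ
    p→q       : Succ p q
    q→r       : Succ q r
    r<n       : r < n
    unchanged : ∀ k → k ≢ p → k ≢ q → k ≢ r → f k ≡ f' k
    change    : MovePattern (f p) (f q) (f r) (f' p) (f' q) (f' r)

module _ {n} {G : Graph n} (Succ : ℕ → ℕ → Set)
  (adj⇒succ : ∀ a b → Adj G a b → Succ (toℕ a) (toℕ b) ⊎ Succ (toℕ b) (toℕ a))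
  (succ-injective : ∀ {a b d : Fin n} → Succ (toℕ a) (toℕ b) → Succ (toℕ d) (toℕ b) → a ≡ d)
  (succ-functional : ∀ {a b d : Fin n} → Succ (toℕ b) (toℕ a) → Succ (toℕ b) (toℕ d) → a ≡ d) where

  move⇒window : ∀ {c c'} → Move G c c' → Window Succ n (at c) (at c')
  move⇒window {c} {c'} m = orient (adj⇒succ x y adj-xy) (adj⇒succ y z adj-yz)
    where
    open Move m
    change : JumpOrUnjump (at c (toℕ x)) (at c (toℕ y)) (at c (toℕ z)) (at c' (toℕ x)) (at c' (toℕ y)) (at c' (toℕ z))
    change = JumpOrUnjump-resp (at-toℕ c x) (at-toℕ c y) (at-toℕ c z)
                               (at-toℕ c' x) (at-toℕ c' y) (at-toℕ c' z) jump-or-unjump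
    orient : Succ (toℕ x) (toℕ y) ⊎ Succ (toℕ y) (toℕ x) → Succ (toℕ y) (toℕ z) ⊎ Succ (toℕ z) (toℕ y) →
             Window Succ n (at c) (at c')
    orient (inj₁ x→y) (inj₁ y→z) = record
      { p = toℕ x ; q = toℕ y ; r = toℕ z ; p→q = x→y ; q→r = y→z ; r<n = toℕ<n z
      ; unchanged = at-agree same ; change = pattern⁺ change }
    orient (inj₂ y→x) (inj₂ z→y) = record
      { p = toℕ z ; q = toℕ y ; r = toℕ x ; p→q = z→y ; q→r = y→x ; r<n = toℕ<n x
      ; unchanged = λ k k≢z k≢y k≢x → at-agree same k k≢x k≢y k≢z ; change = pattern⁻ change }
    orient (inj₁ x→y) (inj₂ z→y) = ⊥-elim (x≢z (succ-injective x→y z→y))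
    orient (inj₂ y→x) (inj₁ y→z) = ⊥-elim (x≢z (succ-functional y→x y→z))

PathSucc : ℕ → ℕ → Set
PathSucc a b = b ≡ suc a

module _ {n : ℕ} where

  path-adj⇒succ : ∀ (a b : Fin n) → PathAdj a b → PathSucc (toℕ a) (toℕ b) ⊎ PathSucc (toℕ b) (toℕ a)
  path-adj⇒succ a b (inj₁ e) = inj₁ (sym e)
  path-adj⇒succ a b (inj₂ e) = inj₂ (sym e)

  path-succ-injective : ∀ {a b d : Fin n} → PathSucc (toℕ a) (toℕ b) → PathSucc (toℕ d) (toℕ b) → a ≡ d
  path-succ-injective b≡1+a b≡1+d = toℕ-injective (suc-injective (trans (sym b≡1+a) b≡1+d))

  path-succ-functional : ∀ {a b d : Fin n} → PathSucc (toℕ b) (toℕ a) → PathSucc (toℕ b) (toℕ d) → a ≡ d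
  path-succ-functional a≡1+b d≡1+b = toℕ-injective (trans a≡1+b (sym d≡1+b))

  cycle-adj⇒succ : ∀ (a b : Fin n) → CycleAdj n a b → CyclicSucc n (toℕ a) (toℕ b) ⊎ CyclicSucc n (toℕ b) (toℕ a)
  cycle-adj⇒succ a b (inj₁ (inj₁ e))        = inj₁ (inj₁ (sym e))
  cycle-adj⇒succ a b (inj₁ (inj₂ e))        = inj₂ (inj₁ (sym e))
  cycle-adj⇒succ a b (inj₂ (inj₁ (e₀ , e))) = inj₂ (inj₂ (e₀ , e))
  cycle-adj⇒succ a b (inj₂ (inj₂ (e₀ , e))) = inj₁ (inj₂ (e₀ , e))

  succ⇒cycle-adj : ∀ {a b : Fin n} → CyclicSucc n (toℕ a) (toℕ b) → CycleAdj n a b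
  succ⇒cycle-adj (inj₁ e)        = inj₁ (inj₁ (sym e))
  succ⇒cycle-adj (inj₂ (e₀ , e)) = inj₂ (inj₂ (e₀ , e))

  cycle-succ-injective : ∀ {a b d : Fin n} → CyclicSucc n (toℕ a) (toℕ b) → CyclicSucc n (toℕ d) (toℕ b) → a ≡ d
  cycle-succ-injective (inj₁ e₁)       (inj₁ e₂)       = toℕ-injective (suc-injective (trans (sym e₁) e₂))
  cycle-succ-injective (inj₁ e₁)       (inj₂ (e₂ , _)) with () ← trans (sym e₂) e₁
  cycle-succ-injective (inj₂ (e₁ , _)) (inj₁ e₂)       with () ← trans (sym e₁) e₂
  cycle-succ-injective (inj₂ (_ , e₁)) (inj₂ (_ , e₂)) = toℕ-injective (suc-injective (trans e₁ (sym e₂)))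

  cycle-succ-functional : ∀ {a b d : Fin n} → CyclicSucc n (toℕ b) (toℕ a) → CyclicSucc n (toℕ b) (toℕ d) → a ≡ d
  cycle-succ-functional         (inj₁ e₁)       (inj₁ e₂)       = toℕ-injective (trans e₁ (sym e₂))
  cycle-succ-functional {a = a} (inj₁ e₁)       (inj₂ (_ , e₂)) = ⊥-elim (<-irrefl (trans e₁ e₂) (toℕ<n a))
  cycle-succ-functional {d = d} (inj₂ (_ , e₁)) (inj₁ e₂)       = ⊥-elim (<-irrefl (trans e₂ e₁) (toℕ<n d))
  cycle-succ-functional         (inj₂ (e₁ , _)) (inj₂ (e₂ , _)) = toℕ-injective (trans e₁ (sym e₂))

path-move⇒window : ∀ {n} {c c' : Config n} → Move (P n) c c' → Window PathSucc n (at c) (at c')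
path-move⇒window = move⇒window PathSucc path-adj⇒succ path-succ-injective path-succ-functional

cycle-move⇒window : ∀ {n h} {c c' : Config n} → Move (C n h) c c' → Window (CyclicSucc n) n (at c) (at c')
cycle-move⇒window = move⇒window (CyclicSucc _) cycle-adj⇒succ cycle-succ-injective cycle-succ-functional

Reachable-invariant : ∀ {n} {G : Graph n} {X : Set} (f : Config n → X) →
  (∀ {c c'} → Move G c c' → f c ≡ f c') → ∀ {c c'} → Reachable G c c' → f c ≡ f c'
Reachable-invariant f move-invariant = fold (λ c c' → f c ≡ f c') (λ m e → trans (move-invariant m) e) refl

path⊆cycle : ∀ {n} (h : n ≥ 3) {c d : Config n} → Reachable (P n) c d → Reachable (C n h) c d
path⊆cycle h = gmap id λ m → let open Move m in record
  { x = x ; y = y ; z = z ; adj-xy = inj₁ adj-xy ; adj-yz = inj₁ adj-yz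
  ; x≢y = x≢y ; y≢z = y≢z ; x≢z = x≢z ; same = same ; jump-or-unjump = jump-or-unjump }

path-unsolvable : ∀ {n} (h : n ≥ 3) → ¬ Solvable (C n h) → ¬ Solvable (P n)
path-unsolvable h unsolvable (c , hole , d , peg , c⇝d) = unsolvable (c , hole , d , peg , path⊆cycle h c⇝d)

freely⇒solvable : ∀ {n} {G : Graph n} → 0 < n → FreelySolvable G → Solvable G
freely⇒solvable 0<n free = oneOdd true 0 , (fromℕ< 0<n , hole) , free (oneOdd true 0) (fromℕ< 0<n , hole)
  where
  hole : HoleAt (fromℕ< 0<n) (oneOdd true 0)
  hole = subst (λ t → HoleAt (fromℕ< 0<n) (oneOdd true t)) (toℕ-fromℕ< 0<n) (oneOdd-OneOddAt true (fromℕ< 0<n))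

module ProductInvariant where

  open MonoidProduct ·-isMonoid
  open Cyclic tr tr-cyclic

  -- Any M with M(T)M(T)M(F) = M(F)M(F)M(T) and M(F)M(T)M(T) = M(T)M(F)M(F) yields an invariant;
  -- these matrices also satisfy M(b)⁶ = 1, which makes the invariant finitely computable.
  M : Bool → Mat
  M true  = mat 1F 1F 0F 1F
  M false = mat 0F 2F 1F 1F

  M-window : ∀ {a b c a' b' c'} → MovePattern a b c a' b' c' → M a · M b · M c ≡ M a' · M b' · M c'
  M-window jump⁺   = refl
  M-window unjump⁺ = refl
  M-window jump⁻   = refl
  M-window unjump⁻ = refl

  pathProduct : ∀ {n} → Config n → Mat
  pathProduct {n} c = ∏ (M ∘ at c) 0 n

  pathProduct-window : ∀ {n f f'} → Window PathSucc n f f' → ∏ (M ∘ f) 0 n ≡ ∏ (M ∘ f') 0 n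
  pathProduct-window {n} record { p = p ; p→q = refl ; q→r = refl ; r<n = r<n ; unchanged = unchanged ; change = change } =
    ∏-window n p r<n (λ k k≢p k≢q k≢r → cong M (unchanged k k≢p k≢q k≢r)) (M-window change)

  cycleTrace-window : ∀ {n f f'} → 3 ≤ n → Window (CyclicSucc n) n f f' → tr (∏ (M ∘ f) 0 n) ≡ tr (∏ (M ∘ f') 0 n)
  cycleTrace-window {n} 3≤n W =
    t∏-window n p q r 3≤n r<n p→q q→r (λ k k≢p k≢q k≢r → cong M (unchanged k k≢p k≢q k≢r)) (M-window change)
    where open Window W

  pathProduct-invariant : ∀ {n} {c c' : Config n} → Reachable (P n) c c' → pathProduct c ≡ pathProduct c'
  pathProduct-invariant = Reachable-invariant pathProduct (pathProduct-window ∘ path-move⇒window)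

  cycleTrace-invariant : ∀ {n} (h : n ≥ 3) {c c' : Config n} → Reachable (C n h) c c' →
    tr (pathProduct c) ≡ tr (pathProduct c')
  cycleTrace-invariant h = Reachable-invariant (tr ∘ pathProduct) (λ m → cycleTrace-window h (cycle-move⇒window {h = h} m))

  pathProduct-oneOdd : ∀ {n b} {v : Fin n} {c} → OneOddAt b v c → ∀ m → toℕ v + suc m ≡ n →
    pathProduct c ≡ M b ^ toℕ v · (M (not b) · M b ^ m)
  pathProduct-oneOdd {n} {b} {v} {c} odd m v+1+m≡n = begin
    ∏ (M ∘ at c) 0 n                    ≡⟨ cong (∏ (M ∘ at c) 0) (sym v+1+m≡n) ⟩
    ∏ (M ∘ at c) 0 (toℕ v + suc m)      ≡⟨ ∏-single (toℕ v) m away (cong M (trans (at-toℕ c v) (proj₁ odd))) ⟩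
    M b ^ toℕ v · (M (not b) · M b ^ m) ∎
    where
    open ≡-Reasoning
    away : ∀ k → k < toℕ v + suc m → k ≢ toℕ v → M (at c k) ≡ M b
    away k k<n k≢v = cong M (at-OneOddAt odd k (subst (k <_) v+1+m≡n k<n) k≢v)

  cycleTrace-oneOdd : ∀ {n b} {v : Fin n} {c} → OneOddAt b v c → ∀ N → suc N ≡ n →
    tr (pathProduct c) ≡ tr (M (not b) · M b ^ N)
  cycleTrace-oneOdd {n} {b} {v} {c} odd N 1+N≡n = begin
    tr (pathProduct c)                          ≡⟨ cong tr (pathProduct-oneOdd odd m v+1+m≡n) ⟩
    tr (M b ^ toℕ v · (M (not b) · M b ^ m))    ≡⟨ tr-cyclic (M b ^ toℕ v) (M (not b) · M b ^ m) ⟩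
    tr (M (not b) · M b ^ m · M b ^ toℕ v)      ≡⟨ cong tr (·-assoc (M (not b)) (M b ^ m) (M b ^ toℕ v)) ⟩
    tr (M (not b) · (M b ^ m · M b ^ toℕ v))    ≡⟨ cong (λ X → tr (M (not b) · X)) (sym (^-+ (M b) m (toℕ v))) ⟩
    tr (M (not b) · M b ^ (m + toℕ v))          ≡⟨ cong (λ k → tr (M (not b) · M b ^ k)) m+v≡N ⟩
    tr (M (not b) · M b ^ N)                    ∎
    where
    open ≡-Reasoning
    m : ℕ
    m = n ∸ suc (toℕ v)
    v+1+m≡n : toℕ v + suc m ≡ n
    v+1+m≡n = trans (+-suc (toℕ v) m) (m+[n∸m]≡n (toℕ<n v))
    m+v≡N : m + toℕ v ≡ N
    m+v≡N = suc-injective (trans (cong suc (+-comm m (toℕ v))) (trans (sym (+-suc (toℕ v) m)) (trans v+1+m≡n (sym 1+N≡n))))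

  cycle-unsolvable-by-trace : ∀ {n} (h : n ≥ 3) N → suc N ≡ n →
    tr (M false · M true ^ N) ≢ tr (M true · M false ^ N) → ¬ Solvable (C n h)
  cycle-unsolvable-by-trace h N 1+N≡n tr≢ (c , (_ , hole) , d , (_ , peg) , c⇝d) =
    tr≢ (trans (sym (cycleTrace-oneOdd hole N 1+N≡n)) (trans (cycleTrace-invariant h c⇝d) (cycleTrace-oneOdd peg N 1+N≡n)))

  trace-gap : ∀ r k → tr (M false · M true ^ r) ≢ tr (M true · M false ^ r) →
    tr (M false · M true ^ (r + k * 6)) ≢ tr (M true · M false ^ (r + k * 6))
  trace-gap r k gap eq = gap (begin
    tr (M false · M true ^ r)             ≡⟨ cong (λ X → tr (M false · X)) (sym (^-periodic refl r k)) ⟩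
    tr (M false · M true ^ (r + k * 6))   ≡⟨ eq ⟩
    tr (M true · M false ^ (r + k * 6))   ≡⟨ cong (λ X → tr (M true · X)) (^-periodic refl r k) ⟩
    tr (M true · M false ^ r)             ∎)
    where open ≡-Reasoning

  -- Since B⁶ = 1, B^i A B^j with i, j < 6 ranges over the products of one-peg configurations.
  PegProductsAvoid : ℕ → ℕ → Set
  PegProductsAvoid v r = ∀ (i j : Fin 6) → (toℕ i + toℕ j) % 6 ≡ (v + r) % 6 →
    M false ^ toℕ i · (M true · M false ^ toℕ j) ≢ M true ^ v · (M false · M true ^ r)

  pegProductsAvoid? : ∀ v r → Dec (PegProductsAvoid v r)
  pegProductsAvoid? v r = all? λ i → all? λ j →
    ((toℕ i + toℕ j) % 6 ℕ.≟ (v + r) % 6) →-dec ¬? (_ ≟ᴹ M true ^ v · (M false · M true ^ r))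

  path-not-freely-solvable-at : ∀ {n} v r k → v + suc (r + k * 6) ≡ n → PegProductsAvoid v r → ¬ FreelySolvable (P n)
  path-not-freely-solvable-at {n} v r k v+1+m≡n avoid free = refute (free (oneOdd true (toℕ V)) (V , oneOdd-OneOddAt true V))
    where
    open ≡-Reasoning
    V : Fin n
    V = fromℕ< (subst (v <_) v+1+m≡n (m<m+n v z<s))
    m : ℕ
    m = r + k * 6
    toℕ-mod : ∀ a → toℕ (a mod 6) ≡ a % 6
    toℕ-mod a = toℕ-fromℕ< (m%n<n a 6)
    refute : ¬ Σ (Config n) λ d → OnePeg d × Reachable (P n) (oneOdd true (toℕ V)) d
    refute (d , (w , peg) , c⇝d) = avoid (w′ mod 6) (m′ mod 6) residues (begin
      M false ^ toℕ (w′ mod 6) · (M true · M false ^ toℕ (m′ mod 6))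
        ≡⟨ cong₂ (λ i j → M false ^ i · (M true · M false ^ j)) (toℕ-mod w′) (toℕ-mod m′) ⟩
      M false ^ (w′ % 6) · (M true · M false ^ (m′ % 6))
        ≡⟨ cong₂ (λ X Y → X · (M true · Y)) (sym (^-mod refl w′)) (sym (^-mod refl m′)) ⟩
      M false ^ w′ · (M true · M false ^ m′)      ≡⟨ sym (pathProduct-oneOdd peg m′ w+1+m′≡n) ⟩
      pathProduct d                               ≡⟨ sym (pathProduct-invariant c⇝d) ⟩
      pathProduct {n} (oneOdd true (toℕ V))       ≡⟨ pathProduct-oneOdd (oneOdd-OneOddAt true V) m V+1+m≡n ⟩
      M true ^ toℕ V · (M false · M true ^ m)     ≡⟨ cong₂ (λ i X → M true ^ i · (M false · X)) V≡v (^-periodic refl r k) ⟩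
      M true ^ v · (M false · M true ^ r)         ∎)
      where
      V≡v : toℕ V ≡ v
      V≡v = toℕ-fromℕ< _
      V+1+m≡n : toℕ V + suc m ≡ n
      V+1+m≡n = trans (cong (_+ suc m) V≡v) v+1+m≡n
      w′ m′ : ℕ
      w′ = toℕ w
      m′ = n ∸ suc w′
      w+1+m′≡n : w′ + suc m′ ≡ n
      w+1+m′≡n = trans (+-suc w′ m′) (m+[n∸m]≡n (toℕ<n w))
      w+m′≡v+m : w′ + m′ ≡ v + m
      w+m′≡v+m = suc-injective (trans (sym (+-suc w′ m′)) (trans w+1+m′≡n (trans (sym v+1+m≡n) (+-suc v m))))
      residues : (toℕ (w′ mod 6) + toℕ (m′ mod 6)) % 6 ≡ (v + r) % 6
      residues = begin
        (toℕ (w′ mod 6) + toℕ (m′ mod 6)) % 6  ≡⟨ cong₂ (λ i j → (i + j) % 6) (toℕ-mod w′) (toℕ-mod m′) ⟩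
        (w′ % 6 + m′ % 6) % 6                  ≡⟨ sym (%-distribˡ-+ w′ m′ 6) ⟩
        (w′ + m′) % 6                          ≡⟨ cong (_% 6) w+m′≡v+m ⟩
        (v + (r + k * 6)) % 6                  ≡⟨ cong (_% 6) (sym (+-assoc v r (k * 6))) ⟩
        (v + r + k * 6) % 6                    ≡⟨ [m+kn]%n≡m%n (v + r) k 6 ⟩
        (v + r) % 6                            ∎

open ProductInvariant

module ParityInvariant where

  xor-isMonoid : IsMonoid _≡_ _xor_ false
  xor-isMonoid = CommutativeRing.+-isMonoid xor-∧-commutativeRing

  open MonoidProduct xor-isMonoid
  open Cyclic id xor-comm

  residue : ℕ → 𝔽₃
  residue zero    = 0F
  residue (suc k) = residue k +₃ 1F

  nonzero : 𝔽₃ → Bool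
  nonzero 0F = false
  nonzero _  = true

  weight : ℕ → Bool
  weight k = nonzero (residue k)

  pegParity : ∀ {n} → Config n → Bool
  pegParity {n} c = ∏ (λ k → weight k ∧ at c k) 0 n

  residue-mul3 : ∀ q → residue (q * 3) ≡ 0F
  residue-mul3 zero    = refl
  residue-mul3 (suc q) = cong (λ x → x +₃ 1F +₃ 1F +₃ 1F) (residue-mul3 q)

  residue-succ : ∀ {n a b} → residue n ≡ 0F → CyclicSucc n a b → residue b ≡ residue a +₃ 1F
  residue-succ _    (inj₁ refl)          = refl
  residue-succ ρn≡0 (inj₂ (refl , refl)) = sym ρn≡0

  windowParity : 𝔽₃ → Bool → Bool → Bool → Bool
  windowParity ρ a b c = ((nonzero ρ ∧ a) xor (nonzero (ρ +₃ 1F) ∧ b)) xor (nonzero (ρ +₃ 1F +₃ 1F) ∧ c)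

  windowParity-move : ∀ {a b c a' b' c'} → MovePattern a b c a' b' c' →
    ∀ ρ → windowParity ρ a b c ≡ windowParity ρ a' b' c'
  windowParity-move jump⁺   = from-yes (all? λ ρ → windowParity ρ true  true  false ≟ᴮ windowParity ρ false false true)
  windowParity-move unjump⁺ = from-yes (all? λ ρ → windowParity ρ false false true  ≟ᴮ windowParity ρ true  true  false)
  windowParity-move jump⁻   = from-yes (all? λ ρ → windowParity ρ false true  true  ≟ᴮ windowParity ρ true  false false)
  windowParity-move unjump⁻ = from-yes (all? λ ρ → windowParity ρ true  false false ≟ᴮ windowParity ρ false true  true)

  pegParity-window : ∀ {n f f'} → 3 ≤ n → residue n ≡ 0F → Window (CyclicSucc n) n f f' →
    ∏ (λ k → weight k ∧ f k) 0 n ≡ ∏ (λ k → weight k ∧ f' k) 0 n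
  pegParity-window {n} {f} {f'} 3≤n ρn≡0 W =
    t∏-window n p q r 3≤n r<n p→q q→r (λ k k≢p k≢q k≢r → cong (weight k ∧_) (unchanged k k≢p k≢q k≢r)) window
    where
    open Window W
    ρq : residue q ≡ residue p +₃ 1F
    ρq = residue-succ ρn≡0 p→q
    ρr : residue r ≡ residue p +₃ 1F +₃ 1F
    ρr = trans (residue-succ ρn≡0 q→r) (cong (_+₃ 1F) ρq)
    window : ((weight p ∧ f p) xor (weight q ∧ f q)) xor (weight r ∧ f r) ≡
             ((weight p ∧ f' p) xor (weight q ∧ f' q)) xor (weight r ∧ f' r)
    window = subst₂ (λ x y → ((weight p ∧ f p) xor (nonzero x ∧ f q)) xor (nonzero y ∧ f r) ≡
                             ((weight p ∧ f' p) xor (nonzero x ∧ f' q)) xor (nonzero y ∧ f' r))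
                    (sym ρq) (sym ρr) (windowParity-move change (residue p))

  pegParity-invariant : ∀ {n} (h : n ≥ 3) → 3 ∣ n → ∀ {c c' : Config n} → Reachable (C n h) c c' →
    pegParity c ≡ pegParity c'
  pegParity-invariant h (divides q refl) =
    Reachable-invariant pegParity (λ m → pegParity-window h (residue-mul3 q) (cycle-move⇒window {h = h} m))

  ∏-weight-mul3 : ∀ s q → ∏ weight s (q * 3) ≡ false
  ∏-weight-mul3 s zero    = refl
  ∏-weight-mul3 s (suc q) =
    trans (cong (λ x → weight s xor (weight (1 + s) xor (weight (2 + s) xor x))) (∏-weight-mul3 (3 + s) q)) (triple (residue s))
    where
    triple : ∀ ρ → nonzero ρ xor (nonzero (ρ +₃ 1F) xor (nonzero (ρ +₃ 1F +₃ 1F) xor false)) ≡ false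
    triple = from-yes (all? λ ρ → nonzero ρ xor (nonzero (ρ +₃ 1F) xor (nonzero (ρ +₃ 1F +₃ 1F) xor false)) ≟ᴮ false)

  pegParity-hole₀ : ∀ q {v : Fin (q * 3)} {c} → toℕ v ≡ 0 → OneOddAt true v c → pegParity c ≡ false
  pegParity-hole₀ q {v} {c} v≡0 hole = trans (∏-cong 0 (q * 3) onlyPegs) (∏-weight-mul3 0 q)
    where
    onlyPegs : ∀ k → 0 ≤ k → k < q * 3 → weight k ∧ at c k ≡ weight k
    onlyPegs zero    _ _   = refl
    onlyPegs (suc k) _ k<n =
      trans (cong (weight (suc k) ∧_) (at-OneOddAt hole (suc k) k<n (1+n≢0 ∘ λ 1+k≡v → trans 1+k≡v v≡0))) (∧-identityʳ _)

  pegParity-peg₁ : ∀ {n} {v : Fin n} {c} → toℕ v ≡ 1 → OneOddAt false v c → pegParity c ≡ true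
  pegParity-peg₁ {n} {v} {c} v≡1 peg = begin
    ∏ φ 0 n                             ≡⟨ cong (∏ φ 0) (sym 2+m≡n) ⟩
    ∏ φ 0 (1 + suc m)                   ≡⟨ ∏-single 1 m others (cong (weight 1 ∧_) at₁) ⟩
    false ^ 1 xor (true xor false ^ m)  ≡⟨ cong (true xor_) (ε^ m) ⟩
    true                                ∎
    where
    open ≡-Reasoning
    φ : ℕ → Bool
    φ k = weight k ∧ at c k
    m : ℕ
    m = n ∸ 2
    2+m≡n : 1 + suc m ≡ n
    2+m≡n = m+[n∸m]≡n (subst (_< n) v≡1 (toℕ<n v))
    at₁ : at c 1 ≡ true
    at₁ = subst (λ k → at c k ≡ true) v≡1 (trans (at-toℕ c v) (proj₁ peg))
    others : ∀ k → k < 1 + suc m → k ≢ 1 → φ k ≡ false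
    others k k<n k≢1 =
      trans (cong (weight k ∧_) (at-OneOddAt peg k (subst (k <_) 2+m≡n k<n) (k≢1 ∘ (λ k≡v → trans k≡v v≡1)))) (∧-zeroʳ _)

  cycle-not-doubly-freely-solvable : ∀ {n} (h : n ≥ 3) → 3 ∣ n → ¬ DoublyFreelySolvable (C n h)
  cycle-not-doubly-freely-solvable {n} h 3∣n@(divides q refl) doubly = refute (doubly (oneOdd true 0) (V₀ , hole) V₁)
    where
    0<n : 0 < n
    0<n = ≤-trans (s≤s z≤n) h
    1<n : 1 < n
    1<n = ≤-trans (s≤s (s≤s z≤n)) h
    V₀ V₁ : Fin n
    V₀ = fromℕ< 0<n
    V₁ = fromℕ< 1<n
    hole : OneOddAt true V₀ (oneOdd true 0)
    hole = subst (λ t → OneOddAt true V₀ (oneOdd true t)) (toℕ-fromℕ< 0<n) (oneOdd-OneOddAt true V₀)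
    refute : ¬ Σ (Config n) λ d → PegAt V₁ d × Reachable (C n h) (oneOdd true 0) d
    refute (d , peg , c⇝d) with () ← trans (sym (pegParity-hole₀ q (toℕ-fromℕ< 0<n) hole))
                                          (trans (pegParity-invariant h 3∣n c⇝d) (pegParity-peg₁ (toℕ-fromℕ< 1<n) peg))

open ParityInvariant using (cycle-not-doubly-freely-solvable)

-- Move sequences on words

idx : List Bool → ℕ → Bool
idx []      _       = false
idx (b ∷ w) zero    = b
idx (b ∷ w) (suc k) = idx w k

⟦_⟧ : ∀ {n} → List Bool → Config n
⟦ w ⟧ j = idx w (toℕ j)

data Step : List Bool → List Bool → Set where
  here  : ∀ {a b c a' b' c' w} → MovePattern a b c a' b' c' → Step (a ∷ b ∷ c ∷ w) (a' ∷ b' ∷ c' ∷ w)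
  there : ∀ {x w w'} → Step w w' → Step (x ∷ w) (x ∷ w')

Steps : List Bool → List Bool → Set
Steps = Star Step

pattern⇒jumpOrUnjump : ∀ {a b c a' b' c'} → MovePattern a b c a' b' c' →
  JumpOrUnjump a b c a' b' c' ⊎ JumpOrUnjump c b a c' b' a'
pattern⇒jumpOrUnjump jump⁺   = inj₁ (inj₁ (refl , refl , refl , refl , refl , refl))
pattern⇒jumpOrUnjump unjump⁺ = inj₁ (inj₂ (refl , refl , refl , refl , refl , refl))
pattern⇒jumpOrUnjump jump⁻   = inj₂ (inj₁ (refl , refl , refl , refl , refl , refl))
pattern⇒jumpOrUnjump unjump⁻ = inj₂ (inj₂ (refl , refl , refl , refl , refl , refl))

Move-suc : ∀ {n} {c c' : Config (suc n)} → Move (P n) (c ∘ suc) (c' ∘ suc) → c zero ≡ c' zero → Move (P (suc n)) c c'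
Move-suc m c₀≡c'₀ = record
  { x = suc x ; y = suc y ; z = suc z ; adj-xy = shift adj-xy ; adj-yz = shift adj-yz
  ; x≢y = x≢y ∘ Fin.suc-injective ; y≢z = y≢z ∘ Fin.suc-injective ; x≢z = x≢z ∘ Fin.suc-injective
  ; same = λ { zero    _ _ _       → sym c₀≡c'₀
             ; (suc w) w≢x w≢y w≢z → same w (w≢x ∘ cong suc) (w≢y ∘ cong suc) (w≢z ∘ cong suc) }
  ; jump-or-unjump = jump-or-unjump }
  where
  open Move m
  shift : ∀ {i j} → PathAdj i j → PathAdj (suc i) (suc j)
  shift (inj₁ e) = inj₁ (cong suc e)
  shift (inj₂ e) = inj₂ (cong suc e)

stepMove : ∀ {w w'} → Step w w' → Move (P (length w)) ⟦ w ⟧ ⟦ w' ⟧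
stepMove (here change) with pattern⇒jumpOrUnjump change
... | inj₁ j = record
  { x = 0F ; y = 1F ; z = 2F ; adj-xy = inj₁ refl ; adj-yz = inj₁ refl
  ; x≢y = λ () ; y≢z = λ () ; x≢z = λ ()
  ; same = λ { 0F w≢0 _ _ → ⊥-elim (w≢0 refl) ; 1F _ w≢1 _ → ⊥-elim (w≢1 refl) ; 2F _ _ w≢2 → ⊥-elim (w≢2 refl)
             ; (suc (suc (suc w))) _ _ _ → refl }
  ; jump-or-unjump = j }
... | inj₂ j = record
  { x = 2F ; y = 1F ; z = 0F ; adj-xy = inj₂ refl ; adj-yz = inj₂ refl
  ; x≢y = λ () ; y≢z = λ () ; x≢z = λ ()
  ; same = λ { 0F _ _ w≢0 → ⊥-elim (w≢0 refl) ; 1F _ w≢1 _ → ⊥-elim (w≢1 refl) ; 2F w≢2 _ _ → ⊥-elim (w≢2 refl)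
             ; (suc (suc (suc w))) _ _ _ → refl }
  ; jump-or-unjump = j }
stepMove (there s) = Move-suc (stepMove s) refl

step-length : ∀ {w w'} → Step w w' → length w ≡ length w'
step-length (here _)  = refl
step-length (there s) = cong suc (step-length s)

steps⇒reachable : ∀ {n w w'} → Steps w w' → length w ≡ n → Reachable (P n) ⟦ w ⟧ ⟦ w' ⟧
steps⇒reachable ε          refl = ε
steps⇒reachable (s ◅ ss) refl = stepMove s ◅ steps⇒reachable ss (sym (step-length s))

steps-++ˡ : ∀ u {w w'} → Steps w w' → Steps (u ++ w) (u ++ w')
steps-++ˡ u = gmap (u ++_) (there* u)
  where
  there* : ∀ u {w w'} → Step w w' → Step (u ++ w) (u ++ w')
  there* []      s = s
  there* (x ∷ u) s = there (there* u s)

-- A move is legal exactly on a window whose outer vertices differ, and it flips all three.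
flip₃ : List Bool → Maybe (List Bool)
flip₃ (a ∷ b ∷ c ∷ w) = if a xor c then just (not a ∷ not b ∷ not c ∷ w) else nothing
flip₃ _               = nothing

moveAt : ℕ → List Bool → Maybe (List Bool)
moveAt zero    w       = flip₃ w
moveAt (suc i) []      = nothing
moveAt (suc i) (x ∷ w) = Maybe.map (x ∷_) (moveAt i w)

play : List ℕ → List Bool → Maybe (List Bool)
play []       w = just w
play (i ∷ is) w = moveAt i w >>= play is

flip₃-sound : ∀ {w w'} → flip₃ w ≡ just w' → Step w w'
flip₃-sound {true  ∷ true  ∷ false ∷ _} refl = here jump⁺
flip₃-sound {false ∷ false ∷ true  ∷ _} refl = here unjump⁺
flip₃-sound {false ∷ true  ∷ true  ∷ _} refl = here jump⁻
flip₃-sound {true  ∷ false ∷ false ∷ _} refl = here unjump⁻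

moveAt-sound : ∀ i {w w'} → moveAt i w ≡ just w' → Step w w'
moveAt-sound zero              eq = flip₃-sound eq
moveAt-sound (suc i) {x ∷ w} eq with moveAt i w in eq′
... | just _ with refl ← eq = there (moveAt-sound i eq′)

play-sound : ∀ is {w w'} → play is w ≡ just w' → Steps w w'
play-sound []       refl = ε
play-sound (i ∷ is) {w} eq with moveAt i w in eq′
... | just w″ = moveAt-sound i eq′ ◅ play-sound is eq

shift₃ : ∀ y Z → Steps (not y ∷ y ∷ y ∷ y ∷ Z) (y ∷ y ∷ y ∷ not y ∷ Z)
shift₃ true  Z = play-sound (0 ∷ 1 ∷ []) refl
shift₃ false Z = play-sound (0 ∷ 1 ∷ []) refl

clear-blocks : ∀ pre → (∀ Z → Steps (pre ++ replicate 6 true ++ Z) (replicate 6 false ++ pre ++ Z)) →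
  ∀ {S T} → Steps (pre ++ S) T → ∀ k → Steps (pre ++ replicate (k * 6) true ++ S) (replicate (k * 6) false ++ T)
clear-blocks pre clear base zero    = base
clear-blocks pre clear base (suc k) = clear _ ◅◅ steps-++ˡ (replicate 6 false) (clear-blocks pre clear base k)

clear-after-FT : ∀ Z → Steps (false ∷ true ∷ replicate 6 true ++ Z) (replicate 6 false ++ false ∷ true ∷ Z)
clear-after-FT Z = play-sound (0 ∷ 1 ∷ 3 ∷ 2 ∷ 0 ∷ 5 ∷ 3 ∷ 2 ∷ 4 ∷ 5 ∷ []) refl

clear-after-TFT : ∀ Z → Steps (true ∷ false ∷ true ∷ replicate 6 true ++ Z) (replicate 6 false ++ true ∷ false ∷ true ∷ Z)
clear-after-TFT Z = play-sound (1 ∷ 0 ∷ 3 ∷ 2 ∷ 5 ∷ 4 ∷ []) refl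

idx-rep : ∀ b y k → k < b → idx (replicate b y) k ≡ y
idx-rep (suc b) y zero    _         = refl
idx-rep (suc b) y (suc k) (s≤s k<b) = idx-rep b y k k<b

idx-oneOdd : ∀ y a b k → k < a + suc b → idx (replicate a y ++ not y ∷ replicate b y) k ≡ y xor does (k ℕ.≟ a)
idx-oneOdd y zero    b zero    _         = sym (trans (xor-comm y true) (true-xor y))
idx-oneOdd y zero    b (suc k) (s≤s k<b) = trans (idx-rep b y k k<b) (sym (xor-identityʳ y))
idx-oneOdd y (suc a) b zero    _         = sym (xor-identityʳ y)
idx-oneOdd y (suc a) b (suc k) (s≤s k<n) = idx-oneOdd y a b k k<n

word-oneOdd : ∀ {n} y a b → a + suc b ≡ n → ∀ j → ⟦ replicate a y ++ not y ∷ replicate b y ⟧ j ≡ oneOdd {n} y a j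
word-oneOdd y a b a+1+b≡n j = idx-oneOdd y a b (toℕ j) (subst (toℕ j <_) (sym a+1+b≡n) (toℕ<n j))

-- Reachability up to pointwise equality

module _ {n} {G : Graph n} where

  Move-respˡ : ∀ {c c' d : Config n} → c ≗ c' → Move G c' d → Move G c d
  Move-respˡ c≗c' m = record
    { x = x ; y = y ; z = z ; adj-xy = adj-xy ; adj-yz = adj-yz ; x≢y = x≢y ; y≢z = y≢z ; x≢z = x≢z
    ; same = λ w w≢x w≢y w≢z → trans (same w w≢x w≢y w≢z) (sym (c≗c' w))
    ; jump-or-unjump = JumpOrUnjump-resp (c≗c' x) (c≗c' y) (c≗c' z) refl refl refl jump-or-unjump }
    where open Move m

  Move-sym : ∀ {c d : Config n} → Move G c d → Move G d c
  Move-sym m = record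
    { x = x ; y = y ; z = z ; adj-xy = adj-xy ; adj-yz = adj-yz ; x≢y = x≢y ; y≢z = y≢z ; x≢z = x≢z
    ; same = λ w w≢x w≢y w≢z → sym (same w w≢x w≢y w≢z)
    ; jump-or-unjump = swap jump-or-unjump }
    where
    open Move m
    swap : ∀ {a b c a' b' c'} → JumpOrUnjump a b c a' b' c' → JumpOrUnjump a' b' c' a b c
    swap (inj₁ (e₁ , e₂ , e₃ , e₄ , e₅ , e₆)) = inj₂ (e₄ , e₅ , e₆ , e₁ , e₂ , e₃)
    swap (inj₂ (e₁ , e₂ , e₃ , e₄ , e₅ , e₆)) = inj₁ (e₄ , e₅ , e₆ , e₁ , e₂ , e₃)

-- Configurations are functions, so the target is only reached up to pointwise equality.
infix 4 _⊢_⇝_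
_⊢_⇝_ : ∀ {n} → Graph n → Config n → Config n → Set
_⊢_⇝_ {n} G c d = Σ (Config n) λ d' → Reachable G c d' × d' ≗ d

module _ {n} {G : Graph n} where

  ⇝-reachable : ∀ {c d : Config n} → Reachable G c d → G ⊢ c ⇝ d
  ⇝-reachable r = _ , r , λ _ → refl

  ⇝-respˡ : ∀ {c c' d : Config n} → c ≗ c' → G ⊢ c' ⇝ d → G ⊢ c ⇝ d
  ⇝-respˡ {c} c≗c' (_ , ε     , d'≗d) = c , ε , λ j → trans (c≗c' j) (d'≗d j)
  ⇝-respˡ     c≗c' (d' , m ◅ r , d'≗d) = d' , Move-respˡ c≗c' m ◅ r , d'≗d

  ⇝-respʳ : ∀ {c d d' : Config n} → d ≗ d' → G ⊢ c ⇝ d → G ⊢ c ⇝ d'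
  ⇝-respʳ d≗d' (e , r , e≗d) = e , r , λ j → trans (e≗d j) (d≗d' j)

  infixr 5 _⨾_
  _⨾_ : ∀ {c d e : Config n} → G ⊢ c ⇝ d → G ⊢ d ⇝ e → G ⊢ c ⇝ e
  (d' , r , d'≗d) ⨾ d⇝e with e' , r' , e'≗e ← ⇝-respˡ d'≗d d⇝e = e' , r ◅◅ r' , e'≗e

  ⇝-sym : ∀ {c d : Config n} → G ⊢ c ⇝ d → G ⊢ d ⇝ c
  ⇝-sym (d' , r , d'≗d) = ⇝-respˡ (λ j → sym (d'≗d j)) (⇝-reachable (reverse Move-sym r))

⇝-path⊆cycle : ∀ {n} (h : n ℕ.≥ 3) {c d : Config n} → P n ⊢ c ⇝ d → C n h ⊢ c ⇝ d
⇝-path⊆cycle h (d' , r , d'≗d) = d' , path⊆cycle h r , d'≗d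

⇝-pegAt : ∀ {n} {G : Graph n} {c} (v : Fin n) → G ⊢ c ⇝ oneOdd false (toℕ v) →
  Σ (Config n) λ d → PegAt v d × Reachable G c d
⇝-pegAt v (d , c⇝d , d≗) =
  d , (trans (d≗ v) (proj₁ peg) , λ w w≢v → trans (d≗ w) (proj₂ peg w w≢v)) , c⇝d
  where
  peg : OneOddAt false v (oneOdd false (toℕ v))
  peg = oneOdd-OneOddAt false v

length-oneOddWord : ∀ y a b → length (replicate a y ++ not y ∷ replicate b y) ≡ a + suc b
length-oneOddWord y a b = trans (length-++ (replicate a y)) (cong₂ _+_ (length-replicate a) (cong suc (length-replicate b)))

steps⇒⇝ : ∀ {n X Y} y y' a ra b rb → Steps X Y →
  X ≡ replicate a y ++ not y ∷ replicate ra y → Y ≡ replicate b y' ++ not y' ∷ replicate rb y' →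
  a + suc ra ≡ n → b + suc rb ≡ n → P n ⊢ oneOdd y a ⇝ oneOdd y' b
steps⇒⇝ y y' a ra b rb X⇝Y refl refl a+1+ra≡n b+1+rb≡n =
  ⇝-respˡ (λ j → sym (word-oneOdd y a ra a+1+ra≡n j))
    (⇝-respʳ (word-oneOdd y' b rb b+1+rb≡n)
      (⇝-reachable (steps⇒reachable X⇝Y (trans (length-oneOddWord y a ra) a+1+ra≡n))))

++-replicate : ∀ m j (y : Bool) → replicate m y ++ replicate j y ≡ replicate (m + j) y
++-replicate zero    j y = refl
++-replicate (suc m) j y = cong (y ∷_) (++-replicate m j y)

++-replicate-++ : ∀ m j (y : Bool) w → replicate m y ++ replicate j y ++ w ≡ replicate (m + j) y ++ w
++-replicate-++ zero    j y w = refl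
++-replicate-++ (suc m) j y w = cong (y ∷_) (++-replicate-++ m j y w)

-- Solutions on paths

record PathSolution (n : ℕ) : Set where
  field
    hole peg : ℕ
    hole<n   : hole < n
    peg<n    : peg < n
    solution : P n ⊢ oneOdd true hole ⇝ oneOdd false peg

steps⇒pathSolution : ∀ {n X Y} a ra b rb → Steps X Y →
  X ≡ replicate a true ++ false ∷ replicate ra true → Y ≡ replicate b false ++ true ∷ replicate rb false →
  a + suc ra ≡ n → b + suc rb ≡ n → PathSolution n
steps⇒pathSolution a ra b rb X⇝Y X≡ Y≡ a+1+ra≡n b+1+rb≡n = record
  { hole = a ; peg = b
  ; hole<n = subst (a <_) a+1+ra≡n (m<m+n a z<s) ; peg<n = subst (b <_) b+1+rb≡n (m<m+n b z<s)
  ; solution = steps⇒⇝ true false a ra b rb X⇝Y X≡ Y≡ a+1+ra≡n b+1+rb≡n }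

path-solution₀ : ∀ k → PathSolution (6 + k * 6)
path-solution₀ k = steps⇒pathSolution 1 (suc (k * 6 + 3)) (k * 6 + 1) 4 moves
  (cong (λ w → true ∷ false ∷ true ∷ w) (++-replicate (k * 6) 3 true)) (++-replicate-++ (k * 6) 1 false _)
  (cong (3 +_) (+-comm (k * 6) 3)) (trans (+-assoc (k * 6) 1 5) (+-comm (k * 6) 6))
  where
  moves : Steps (true ∷ false ∷ true ∷ replicate (k * 6) true ++ replicate 3 true)
                (replicate (k * 6) false ++ false ∷ true ∷ replicate 4 false)
  moves = clear-blocks (true ∷ false ∷ true ∷ []) clear-after-TFT (play-sound (1 ∷ 0 ∷ 3 ∷ 1 ∷ []) refl) k

path-solution₂ : ∀ k → PathSolution (2 + k * 6)
path-solution₂ k = steps⇒pathSolution 0 (suc (k * 6 + 0)) (k * 6 + 1) 0 moves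
  (cong (λ w → false ∷ true ∷ w) (++-replicate (k * 6) 0 true)) (++-replicate-++ (k * 6) 1 false _)
  (cong (2 +_) (+-identityʳ (k * 6))) (trans (+-assoc (k * 6) 1 1) (+-comm (k * 6) 2))
  where
  moves : Steps (false ∷ true ∷ replicate (k * 6) true ++ replicate 0 true)
                (replicate (k * 6) false ++ false ∷ true ∷ [])
  moves = clear-blocks (false ∷ true ∷ []) clear-after-FT ε k

path-solution₃ : ∀ k → PathSolution (3 + k * 6)
path-solution₃ k = steps⇒pathSolution 0 (suc (k * 6 + 1)) (k * 6) 2 moves
  (cong (λ w → false ∷ true ∷ w) (++-replicate (k * 6) 1 true)) refl
  (cong (2 +_) (+-comm (k * 6) 1)) (+-comm (k * 6) 3)
  where
  moves : Steps (false ∷ true ∷ replicate (k * 6) true ++ replicate 1 true)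
                (replicate (k * 6) false ++ true ∷ false ∷ false ∷ [])
  moves = clear-blocks (false ∷ true ∷ []) clear-after-FT (play-sound (0 ∷ []) refl) k

path-solution₄ : ∀ k → PathSolution (4 + k * 6)
path-solution₄ k = steps⇒pathSolution 1 (suc (k * 6 + 1)) (k * 6 + 2) 1 moves
  (cong (λ w → true ∷ false ∷ true ∷ w) (++-replicate (k * 6) 1 true)) (++-replicate-++ (k * 6) 2 false _)
  (cong (3 +_) (+-comm (k * 6) 1)) (trans (+-assoc (k * 6) 2 2) (+-comm (k * 6) 4))
  where
  moves : Steps (true ∷ false ∷ true ∷ replicate (k * 6) true ++ replicate 1 true)
                (replicate (k * 6) false ++ false ∷ false ∷ true ∷ false ∷ [])
  moves = clear-blocks (true ∷ false ∷ true ∷ []) clear-after-TFT (play-sound (1 ∷ 0 ∷ []) refl) k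

-- Rotating the cycle

module _ {m : ℕ} where

  rotate : Fin (suc m) → Fin (suc m)
  rotate j with suc (toℕ j) <? suc m
  ... | yes j+1<n = fromℕ< j+1<n
  ... | no  _     = zero

  rotate⁻¹ : Fin (suc m) → Fin (suc m)
  rotate⁻¹ zero    = fromℕ m
  rotate⁻¹ (suc j) = inject₁ j

  rotate-succ : ∀ j → CyclicSucc (suc m) (toℕ j) (toℕ (rotate j))
  rotate-succ j with suc (toℕ j) <? suc m
  ... | yes j+1<n = inj₁ (toℕ-fromℕ< j+1<n)
  ... | no  j+1≮n with m≤n⇒m<n∨m≡n (toℕ<n j)
  ...   | inj₁ j+1<n = ⊥-elim (j+1≮n j+1<n)
  ...   | inj₂ j+1≡n = inj₂ (refl , j+1≡n)

  rotate⁻¹-succ : ∀ j → CyclicSucc (suc m) (toℕ (rotate⁻¹ j)) (toℕ j)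
  rotate⁻¹-succ zero    = inj₂ (refl , cong suc (toℕ-fromℕ m))
  rotate⁻¹-succ (suc j) = inj₁ (cong suc (sym (toℕ-inject₁ j)))

  rotate-rotate⁻¹ : ∀ j → rotate (rotate⁻¹ j) ≡ j
  rotate-rotate⁻¹ j = cycle-succ-functional (rotate-succ (rotate⁻¹ j)) (rotate⁻¹-succ j)

  rotate⁻¹-rotate : ∀ j → rotate⁻¹ (rotate j) ≡ j
  rotate⁻¹-rotate j = cycle-succ-injective (rotate⁻¹-succ (rotate j)) (rotate-succ j)

  rotate-preserves-succ : ∀ {a b} → CyclicSucc (suc m) (toℕ a) (toℕ b) →
    CyclicSucc (suc m) (toℕ (rotate a)) (toℕ (rotate b))
  rotate-preserves-succ {a} {b} a→b = subst (λ x → CyclicSucc (suc m) (toℕ x) (toℕ (rotate b))) rotate-a≡b (rotate-succ b)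
    where
    rotate-a≡b : b ≡ rotate a
    rotate-a≡b = sym (cycle-succ-functional (rotate-succ a) a→b)

module _ {m} (h : suc m ℕ.≥ 3) where

  rotate-adj : ∀ {a b} → CycleAdj (suc m) a b → CycleAdj (suc m) (rotate a) (rotate b)
  rotate-adj {a} {b} a~b with cycle-adj⇒succ a b a~b
  ... | inj₁ a→b = succ⇒cycle-adj (rotate-preserves-succ a→b)
  ... | inj₂ b→a = adj-sym (C (suc m) h) (succ⇒cycle-adj (rotate-preserves-succ b→a))

  rotate-move : ∀ {c d} → Move (C (suc m) h) c d → Move (C (suc m) h) (c ∘ rotate⁻¹) (d ∘ rotate⁻¹)
  rotate-move {c} {d} mv = record
    { x = rotate x ; y = rotate y ; z = rotate z ; adj-xy = rotate-adj adj-xy ; adj-yz = rotate-adj adj-yz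
    ; x≢y = x≢y ∘ rotate-injective ; y≢z = y≢z ∘ rotate-injective ; x≢z = x≢z ∘ rotate-injective
    ; same = λ w w≢x w≢y w≢z → same (rotate⁻¹ w) (avoid w≢x) (avoid w≢y) (avoid w≢z)
    ; jump-or-unjump = JumpOrUnjump-resp (back c x) (back c y) (back c z) (back d x) (back d y) (back d z) jump-or-unjump }
    where
    open Move mv
    rotate-injective : ∀ {a b} → rotate a ≡ rotate b → a ≡ b
    rotate-injective {a} {b} e = trans (sym (rotate⁻¹-rotate a)) (trans (cong rotate⁻¹ e) (rotate⁻¹-rotate b))
    avoid : ∀ {w a} → ¬ w ≡ rotate a → ¬ rotate⁻¹ w ≡ a
    avoid {w} w≢ e = w≢ (trans (sym (rotate-rotate⁻¹ w)) (cong rotate e))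
    back : ∀ (f : Config (suc m)) a → f (rotate⁻¹ (rotate a)) ≡ f a
    back f a = cong f (rotate⁻¹-rotate a)

  ⇝-rotate : ∀ {c d c' d'} → C (suc m) h ⊢ c ⇝ d → (c ∘ rotate⁻¹) ≗ c' → (d ∘ rotate⁻¹) ≗ d' →
    C (suc m) h ⊢ c' ⇝ d'
  ⇝-rotate (e , r , e≗d) c↻≗c' d↻≗d' = ⇝-respˡ (λ j → sym (c↻≗c' j))
    (e ∘ rotate⁻¹ , gmap (_∘ rotate⁻¹) rotate-move r , λ j → trans (e≗d (rotate⁻¹ j)) (d↻≗d' j))

oneOdd-rotate : ∀ {m} y t → t < m → (oneOdd {suc m} y t ∘ rotate⁻¹) ≗ oneOdd y (suc t)
oneOdd-rotate {m} y t t<m zero    = cong (y xor_) (dec-false (toℕ (fromℕ m) ℕ.≟ t) (>⇒≢ t<m ∘ trans (sym (toℕ-fromℕ m))))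
oneOdd-rotate     y t t<m (suc j) = cong (λ k → y xor does (k ℕ.≟ t)) (toℕ-inject₁ j)

oneOdd-rotate-last : ∀ {m} y → (oneOdd {suc m} y m ∘ rotate⁻¹) ≗ oneOdd y 0
oneOdd-rotate-last {m} y zero    = cong (y xor_) (dec-true (toℕ (fromℕ m) ℕ.≟ m) (toℕ-fromℕ m))
oneOdd-rotate-last {m} y (suc j) =
  cong (y xor_) (dec-false (toℕ (inject₁ j) ℕ.≟ m) (<⇒≢ (subst (_< m) (sym (toℕ-inject₁ j)) (toℕ<n j))))

module _ {m} (h : suc m ℕ.≥ 3) where

  HoleSolvable : ℕ → Set
  HoleSolvable s = Σ ℕ λ t → t ≤ m × C (suc m) h ⊢ oneOdd true s ⇝ oneOdd false t

  rotate-solution : ∀ {s s'} → (oneOdd true s ∘ rotate⁻¹) ≗ oneOdd true s' → HoleSolvable s → HoleSolvable s'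
  rotate-solution hole↻ (t , t≤m , sol) with m≤n⇒m<n∨m≡n t≤m
  ... | inj₁ t<m  = suc t , t<m , ⇝-rotate h sol hole↻ (oneOdd-rotate false t t<m)
  ... | inj₂ refl = 0 , z≤n , ⇝-rotate h sol hole↻ (oneOdd-rotate-last false)

  climb : ∀ a d → a + d ≤ m → HoleSolvable a → HoleSolvable (a + d)
  climb a zero    _       sol = subst HoleSolvable (sym (+-identityʳ a)) sol
  climb a (suc d) a+d+1≤m sol =
    subst HoleSolvable (sym (+-suc a d)) (rotate-solution (oneOdd-rotate true (a + d) a+d<m) (climb a d (<⇒≤ a+d<m) sol))
    where
    a+d<m : a + d < m
    a+d<m = subst (_≤ m) (+-suc a d) a+d+1≤m

  every-hole : ∀ {a} → a ≤ m → HoleSolvable a → ∀ s → s ≤ m → HoleSolvable s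
  every-hole {a} a≤m sol s s≤m =
    climb 0 s s≤m (rotate-solution (oneOdd-rotate-last true) (subst HoleSolvable a+[m∸a]≡m top))
    where
    a+[m∸a]≡m : a + (m ∸ a) ≡ m
    a+[m∸a]≡m = m+[n∸m]≡n a≤m
    top : HoleSolvable (a + (m ∸ a))
    top = climb a (m ∸ a) (≤-reflexive a+[m∸a]≡m) sol

cycle-freely-solvable : ∀ {n} (h : n ℕ.≥ 3) → PathSolution n → FreelySolvable (C n h)
cycle-freely-solvable {suc m} h sol c (v , c-hole) =
  finish (every-hole h (≤-pred hole<n) (peg , ≤-pred peg<n , ⇝-path⊆cycle h solution) (toℕ v) (≤-pred (toℕ<n v)))
  where
  open PathSolution sol
  finish : HoleSolvable h (toℕ v) → Σ (Config (suc m)) λ d → OnePeg d × Reachable (C (suc m) h) c d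
  finish (t , t≤m , v⇝t) = map₂ (map₁ (T ,_)) (⇝-pegAt T (subst (λ t → C (suc m) h ⊢ c ⇝ oneOdd false t) (sym T≡t) c⇝t))
    where
    T : Fin (suc m)
    T = fromℕ< (s≤s t≤m)
    T≡t : toℕ T ≡ t
    T≡t = toℕ-fromℕ< (s≤s t≤m)
    c⇝t : C (suc m) h ⊢ c ⇝ oneOdd false t
    c⇝t = ⇝-respˡ (OneOddAt⇒≗ c-hole) v⇝t

module Shifts (m₃ : ℕ) (h : 4 + m₃ ≥ 3) where

  m : ℕ
  m = 3 + m₃

  shift : ∀ y s → 3 + s ≤ m → C (suc m) h ⊢ oneOdd y s ⇝ oneOdd y (3 + s)
  shift y zero    _       = ⇝-path⊆cycle h (steps⇒⇝ y y 0 (3 + m₃) 3 m₃ (shift₃ y (replicate m₃ y)) refl refl refl refl)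
  shift y (suc s) 3+s<m =
    ⇝-rotate h (shift y s (<⇒≤ 3+s<m)) (oneOdd-rotate y s (≤-trans (m≤n+m (suc s) 3) 3+s<m)) (oneOdd-rotate y (3 + s) 3+s<m)

  descend : ∀ y r j → r + j * 3 ≤ m → C (suc m) h ⊢ oneOdd y (r + j * 3) ⇝ oneOdd y r
  descend y r zero    _ = subst (λ s → C (suc m) h ⊢ oneOdd y s ⇝ oneOdd y r) (sym (+-identityʳ r)) (⇝-reachable ε)
  descend y r (suc j) r+[3+3j]≤m =
    subst (λ s → C (suc m) h ⊢ oneOdd y s ⇝ oneOdd y (r + j * 3)) (sym r+[3+3j]≡3+[r+3j])
          (⇝-sym (shift y (r + j * 3) 3+[r+3j]≤m))
    ⨾ descend y r j (≤-trans (m≤n+m (r + j * 3) 3) 3+[r+3j]≤m)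
    where
    r+[3+3j]≡3+[r+3j] : r + (3 + j * 3) ≡ 3 + (r + j * 3)
    r+[3+3j]≡3+[r+3j] = x∙yz≈y∙xz r 3 (j * 3)
    3+[r+3j]≤m : 3 + (r + j * 3) ≤ m
    3+[r+3j]≤m = subst (_≤ m) r+[3+3j]≡3+[r+3j] r+[3+3j]≤m

  wrap₁ : ∀ y → C (suc m) h ⊢ oneOdd y (1 + m₃) ⇝ oneOdd y 0
  wrap₁ y = ⇝-rotate h (shift y m₃ ≤-refl) (oneOdd-rotate y m₃ (m≤n+m (suc m₃) 2)) (oneOdd-rotate-last y)

  wrap₂ : ∀ y → C (suc m) h ⊢ oneOdd y (2 + m₃) ⇝ oneOdd y 1
  wrap₂ y = ⇝-rotate h (wrap₁ y) (oneOdd-rotate y (1 + m₃) (m≤n+m (2 + m₃) 1)) (oneOdd-rotate y 0 (s≤s z≤n))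

  doubly-freely-solvable : (∀ y → C (suc m) h ⊢ oneOdd y 1 ⇝ oneOdd y 0) →
    (∀ y → C (suc m) h ⊢ oneOdd y 2 ⇝ oneOdd y 0) → PathSolution (suc m) → DoublyFreelySolvable (C (suc m) h)
  doubly-freely-solvable 1⇝0 2⇝0 sol c (v , c-hole) t = ⇝-pegAt t (⇝-respˡ (OneOddAt⇒≗ c-hole) v⇝t)
    where
    open PathSolution sol
    to0 : ∀ y s → s ≤ m → C (suc m) h ⊢ oneOdd y s ⇝ oneOdd y 0
    to0 y s s≤m =
      subst (λ s′ → C (suc m) h ⊢ oneOdd y s′ ⇝ oneOdd y (s % 3)) (sym s≡r+3j)
            (descend y (s % 3) (s / 3) (subst (_≤ m) s≡r+3j s≤m))
      ⨾ residue (s % 3) (m%n<n s 3)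
      where
      residue : ∀ r → r < 3 → C (suc m) h ⊢ oneOdd y r ⇝ oneOdd y 0
      residue 0 _ = ⇝-reachable ε
      residue 1 _ = 1⇝0 y
      residue 2 _ = 2⇝0 y
      residue (suc (suc (suc _))) (s≤s (s≤s (s≤s ())))
      s≡r+3j : s ≡ s % 3 + s / 3 * 3
      s≡r+3j = m≡m%n+[m/n]*n s 3
    v⇝t : C (suc m) h ⊢ oneOdd true (toℕ v) ⇝ oneOdd false (toℕ t)
    v⇝t = to0 true (toℕ v) (toℕ≤pred[n] v) ⨾ ⇝-sym (to0 true hole (≤-pred hole<n)) ⨾ ⇝-path⊆cycle h solution
          ⨾ to0 false peg (≤-pred peg<n) ⨾ ⇝-sym (to0 false (toℕ t) (toℕ≤pred[n] t))

-- Shifts by three preserve a position mod 3; since 3 ∤ n, the wrap-arounds reach the other residues.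
cycle-doubly-freely-solvable : ∀ {n} (h : n ≥ 3) → ¬ 3 ∣ n → PathSolution n → DoublyFreelySolvable (C n h)
cycle-doubly-freely-solvable {n} h 3∤n sol with n divMod 3
... | result q 0F refl = ⊥-elim (3∤n (n∣m*n q))
... | result (suc q) 1F refl = doubly-freely-solvable 1⇝0 2⇝0 sol
  where
  open Shifts (q * 3) h
  1⇝0 : ∀ y → _ ⊢ oneOdd y 1 ⇝ oneOdd y 0
  1⇝0 y = ⇝-sym (descend y 1 q (m≤n+m _ 2)) ⨾ wrap₁ y
  2⇝0 : ∀ y → _ ⊢ oneOdd y 2 ⇝ oneOdd y 0
  2⇝0 y = ⇝-sym (descend y 2 q (m≤n+m _ 1)) ⨾ wrap₂ y ⨾ 1⇝0 y
... | result (suc q) 2F refl = doubly-freely-solvable 1⇝0 2⇝0 sol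
  where
  open Shifts (1 + q * 3) h
  2⇝0 : ∀ y → _ ⊢ oneOdd y 2 ⇝ oneOdd y 0
  2⇝0 y = ⇝-sym (descend y 2 q (m≤n+m _ 2)) ⨾ wrap₁ y
  1⇝0 : ∀ y → _ ⊢ oneOdd y 1 ⇝ oneOdd y 0
  1⇝0 y = ⇝-sym (wrap₂ y) ⨾ descend y 0 (suc q) (m≤n+m _ 1)
... | result zero 1F refl with s≤s () ← h
... | result zero 2F refl with s≤s (s≤s ()) ← h

-- Residues mod 6

∣r+k*6⇒∣r : ∀ {d} r k → d ∣ 6 → d ∣ r + k * 6 → d ∣ r
∣r+k*6⇒∣r {d} r k d∣6 d∣n = ∣m+n∣m⇒∣n (subst (d ∣_) (+-comm r (k * 6)) d∣n) (∣-trans d∣6 (n∣m*n k))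

∣r⇒∣r+k*6 : ∀ {d} r k → d ∣ 6 → d ∣ r → d ∣ r + k * 6
∣r⇒∣r+k*6 {d} r k d∣6 d∣r = ∣m∣n⇒∣m+n d∣r (∣-trans d∣6 (n∣m*n k))

cycle-unsolvable₁ : ∀ k (h : 1 + k * 6 ≥ 3) → ¬ Solvable (C (1 + k * 6) h)
cycle-unsolvable₁ k h = cycle-unsolvable-by-trace h (k * 6) refl (trace-gap 0 k λ ())

cycle-unsolvable₅ : ∀ k (h : 5 + k * 6 ≥ 3) → ¬ Solvable (C (5 + k * 6) h)
cycle-unsolvable₅ k h = cycle-unsolvable-by-trace h (4 + k * 6) refl (trace-gap 4 k λ ())

cycle-unsolvable : ∀ {n} (h : n ≥ 3) → ¬ 2 ∣ n → ¬ 3 ∣ n → ¬ Solvable (C n h)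
cycle-unsolvable {n} h 2∤n 3∤n with n divMod 6
... | result k 0F refl = ⊥-elim (2∤n (∣r⇒∣r+k*6 0 k (from-yes (2 ∣? 6)) (from-yes (2 ∣? 0))))
... | result k 1F refl = cycle-unsolvable₁ k h
... | result k 2F refl = ⊥-elim (2∤n (∣r⇒∣r+k*6 2 k (from-yes (2 ∣? 6)) (from-yes (2 ∣? 2))))
... | result k 3F refl = ⊥-elim (3∤n (∣r⇒∣r+k*6 3 k (from-yes (3 ∣? 6)) (from-yes (3 ∣? 3))))
... | result k 4F refl = ⊥-elim (2∤n (∣r⇒∣r+k*6 4 k (from-yes (2 ∣? 6)) (from-yes (2 ∣? 4))))
... | result k 5F refl = cycle-unsolvable₅ k h

coprime-residue : ∀ r k → ¬ 2 ∣ r → ¬ 3 ∣ r → ¬ (2 ∣ r + k * 6 ⊎ 3 ∣ r + k * 6)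
coprime-residue r k 2∤r 3∤r =
  [ 2∤r ∘ ∣r+k*6⇒∣r r k (from-yes (2 ∣? 6)) , 3∤r ∘ ∣r+k*6⇒∣r r k (from-yes (3 ∣? 6)) ]

path-solution : ∀ {n} → n ≥ 3 → 2 ∣ n ⊎ 3 ∣ n → PathSolution n
path-solution {n} h 2∣n⊎3∣n with n divMod 6
... | result (suc k) 0F refl = path-solution₀ k
... | result (suc k) 2F refl = path-solution₂ (suc k)
... | result k       3F refl = path-solution₃ k
... | result k       4F refl = path-solution₄ k
... | result zero    0F refl with () ← h
... | result zero    2F refl with s≤s (s≤s ()) ← h
... | result k       1F refl = ⊥-elim (coprime-residue 1 k (from-no (2 ∣? 1)) (from-no (3 ∣? 1)) 2∣n⊎3∣n)
... | result k       5F refl = ⊥-elim (coprime-residue 5 k (from-no (2 ∣? 5)) (from-no (3 ∣? 5)) 2∣n⊎3∣n)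

path-solvable : ∀ {n} → PathSolution n → Solvable (P n)
path-solvable {n} sol = oneOdd true hole , (v , hole-at-v) , map₂ (map₁ (_ ,_)) (⇝-pegAt (fromℕ< peg<n) peg-reached)
  where
  open PathSolution sol
  v : Fin n
  v = fromℕ< hole<n
  hole-at-v : HoleAt v (oneOdd true hole)
  hole-at-v = subst (λ t → HoleAt v (oneOdd true t)) (toℕ-fromℕ< hole<n) (oneOdd-OneOddAt true v)
  peg-reached : P n ⊢ oneOdd true hole ⇝ oneOdd false (toℕ (fromℕ< peg<n))
  peg-reached = subst (λ t → P n ⊢ oneOdd true hole ⇝ oneOdd false t) (sym (toℕ-fromℕ< peg<n)) solution

path-not-freely-solvable : ∀ {n} → n ≥ 3 → ¬ FreelySolvable (P n)
path-not-freely-solvable {n} h with n divMod 6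
... | result (suc k) 0F refl = path-not-freely-solvable-at 0 5 k refl (from-yes (pegProductsAvoid? 0 5))
... | result (suc k) 2F refl = path-not-freely-solvable-at 2 5 k refl (from-yes (pegProductsAvoid? 2 5))
... | result k       3F refl = path-not-freely-solvable-at 1 1 k refl (from-yes (pegProductsAvoid? 1 1))
... | result k       4F refl = path-not-freely-solvable-at 0 3 k refl (from-yes (pegProductsAvoid? 0 3))
... | result zero    0F refl with () ← h
... | result zero    2F refl with s≤s (s≤s ()) ← h
... | result k       1F refl = path-unsolvable h (cycle-unsolvable₁ k h) ∘ freely⇒solvable (≤-trans (s≤s z≤n) h)
... | result k       5F refl = path-unsolvable h (cycle-unsolvable₅ k h) ∘ freely⇒solvable (≤-trans (s≤s z≤n) h)

theorem3 : (n : ℕ) → (h : n ≥ 3) →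
    ((¬ 2 ∣ n → ¬ 3 ∣ n → ¬ Solvable (P n) × ¬ Solvable (C n h))
    × (3 ∣ n → (Solvable (P n) × ¬ FreelySolvable (P n))
               × (FreelySolvable (C n h) × ¬ DoublyFreelySolvable (C n h)))
    × (¬ 3 ∣ n → 2 ∣ n → (Solvable (P n) × ¬ FreelySolvable (P n))
               × DoublyFreelySolvable (C n h)))
theorem3 n h =
  (λ 2∤n 3∤n → path-unsolvable h (cycle-unsolvable h 2∤n 3∤n) , cycle-unsolvable h 2∤n 3∤n) ,
  (λ 3∣n → (path-solvable (path-solution h (inj₂ 3∣n)) , path-not-freely-solvable h) ,
           (cycle-freely-solvable h (path-solution h (inj₂ 3∣n)) , cycle-not-doubly-freely-solvable h 3∣n)) ,
  (λ 3∤n 2∣n → (path-solvable (path-solution h (inj₁ 2∣n)) , path-not-freely-solvable h) ,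
               cycle-doubly-freely-solvable h 3∤n (path-solution h (inj₁ 2∣n)))
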